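{- For every positive integer $k$ there is a connected finite simple graph $G$ whose node reliability $\operatorname{N}(G;p)$ has at least $k$ maximal intervals of decrease in $(0,1)$.
   Context: For a finite simple graph $G$, the node reliability $\operatorname{N}(G;p)$ is the probability that, when each vertex of $G$ is independently operational with probability $p\in[0,1]$ (edges being perfectly reliable), the set of operational vertices is nonempty and induces a connected subgraph of $G$; it is a polynomial function of $p$. A maximal interval of decrease is a maximal subinterval of $(0,1)$ on which this function is decreasing.
   Formalization: The probability $p$ and the maximal intervals of decrease in (0,1) are taken over ℚ. -}

module Defs where

open import Data.Bool using (Bool; true; false; _∧_; _∨_; not; T)
open import Data.Nat using (ℕ; zero; suc)
open import Data.Fin using (Fin)
open import Data.Vec using (Vec; []; _∷_; lookup)
open import Data.List using (List; []; _∷_; map; _++_; foldr; allFin)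
open import Data.Bool.ListAction using (any; all)
open import Data.Fin.Subset using (Subset; ∣_∣; Nonempty)
open import Data.Rational using (ℚ; 0ℚ; 1ℚ; _+_; _*_; _-_; _<_)
open import Data.Product using (Σ; _×_; _,_; ∃)
open import Data.Empty using (⊥)
open import Relation.Nullary using (¬_)
open import Relation.Binary.PropositionalEquality using (_≡_)

record Graph : Set where
  field
    n      : ℕ
    adj    : Fin n → Fin n → Bool
    sym    : ∀ u v → adj u v ≡ adj v u
    irrefl : ∀ u → adj u u ≡ false
open Graph public

mem : ∀ {m} → Fin m → Subset m → Bool
mem u S = lookup S u

-- reachW G S m u v : there is a walk from u to v of length ≤ m all of
-- whose vertices lie in S (u, v themselves assumed in S by callers).
reachW : (G : Graph) → Subset (n G) → ℕ → Fin (n G) → Fin (n G) → Bool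
reachW G S zero    u v = isEq u v
  where
  isEq : Fin (n G) → Fin (n G) → Bool
  isEq a b with a Data.Fin.≟ b
  ... | Relation.Nullary.yes _ = true
  ... | Relation.Nullary.no  _ = false
reachW G S (suc m) u v =
  reachW G S m u v ∨ any (λ w → mem w S ∧ adj G u w ∧ reachW G S m w v) (allFin (n G))

-- The subgraph of G induced by S is connected: any two vertices of S are
-- joined by a walk inside S (walks of length ≤ n suffice, any walk can be
-- shortened to a path of length < n).
inducedConnected : (G : Graph) → Subset (n G) → Bool
inducedConnected G S =
  all (λ u → all (λ v → not (mem u S ∧ mem v S) ∨ reachW G S (n G) u v)
                                     (allFin (n G)))
                (allFin (n G))

nonemptyB : ∀ {m} → Subset m → Bool
nonemptyB []           = false
nonemptyB (b ∷ S)      = b ∨ nonemptyB S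

Connected : Graph → Set
Connected G = T (nonemptyB {n G} (Data.Vec.replicate (n G) true)) × T (inducedConnected G (Data.Vec.replicate (n G) true))

allSubsets : (m : ℕ) → List (Subset m)
allSubsets zero    = [] ∷ []
allSubsets (suc m) = map (true ∷_) (allSubsets m) ++ map (false ∷_) (allSubsets m)

infixr 8 _^_
_^_ : ℚ → ℕ → ℚ
x ^ zero  = 1ℚ
x ^ suc k = x * (x ^ k)

sumℚ : List ℚ → ℚ
sumℚ = foldr _+_ 0ℚ

nodeRel : Graph → ℚ → ℚ
nodeRel G p = sumℚ (map term (allSubsets (n G)))
  where
  term : Subset (n G) → ℚ
  term S with nonemptyB S ∧ inducedConnected G S
  ... | true  = (p ^ ∣ S ∣) * ((1ℚ - p) ^ (n G Data.Nat.∸ ∣ S ∣))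
  ... | false = 0ℚ

IsInterval : (ℚ → Set) → Set
IsInterval I = (∀ x → I x → 0ℚ < x × x < 1ℚ)
             × (∀ x y z → I x → I z → x < y → y < z → I y)
             × Σ ℚ (λ x → Σ ℚ (λ y → I x × I y × x < y))

DecreasingOn : (ℚ → ℚ) → (ℚ → Set) → Set
DecreasingOn f I = ∀ x y → I x → I y → x < y → f y < f x

MaxDecInterval : (ℚ → ℚ) → (ℚ → Set) → Set₁
MaxDecInterval f I =
  IsInterval I × DecreasingOn f I ×
  (∀ (J : ℚ → Set) → IsInterval J → DecreasingOn f J → (∀ x → I x → J x) → ∀ x → J x → I x)

AtLeastDecIntervals : ℕ → (ℚ → ℚ) → Set₁
AtLeastDecIntervals k f =
  Σ (Fin k → (ℚ → Set)) λ I →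
    (∀ i → MaxDecInterval f (I i)) ×
    (∀ i j → ¬ (i ≡ j) → ∀ x → I i x → I j x → ⊥)

-- The graph is a clique on K + 1 centres, centre j carrying 2^(ρ + σ j) − 1 pendant leaves.
-- A nonempty vertex set induces a connected subgraph iff it is a single vertex or contains the
-- centre of each of its leaves, so that, with c the number of leaves and N + 1 that of vertices,
--   N(G;p) = ∏ⱼ (p + (1 − p)^(mⱼ + 1)) + c p (1 − p)^N − (1 − p)^(N + 1).
-- The factor p + (1 − p)^(m + 1) is about 1 for p ≪ 1/m, about p for p ≫ 1/m, and decreases in
-- between.  With the σ j far apart, near p = ½^σ j the earlier factors are about p, factor j
-- decreases, the later ones are about 1 and the correction terms are negligible, so N decreases;
-- between two such scales N is about p^(number of saturated factors) and increases.

module Submission where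

open import Data.Nat using (ℕ)

module RationalArithmetic where

  open import Defs using (_^_)
  open import Data.Nat as ℕ using (ℕ; zero; suc)
  import Data.Nat.Properties as ℕ
  open import Data.Integer using (+≤+; +<+)
  open import Data.Rational
    using (ℚ; 0ℚ; 1ℚ; ½; _+_; _*_; _-_; -_; _<_; _≤_; *≤*; *<*; nonNegative; nonPositive; positive)
  open import Data.Rational.Properties
  open import Data.Rational.Solver using (module +-*-Solver)
  open import Data.Product using (_,_)
  open import Data.Sum using (inj₁; inj₂)
  open import Relation.Binary.PropositionalEquality

  open +-*-Solver

  fromℕ : ℕ → ℚ
  fromℕ zero    = 0ℚ
  fromℕ (suc n) = 1ℚ + fromℕ n

  0≤1 : 0ℚ ≤ 1ℚ
  0≤1 = *≤* (+≤+ ℕ.z≤n)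

  0<1 : 0ℚ < 1ℚ
  0<1 = *<* (+<+ (ℕ.s≤s ℕ.z≤n))

  0<½ : 0ℚ < ½
  0<½ = *<* (+<+ (ℕ.s≤s ℕ.z≤n))

  0≤½ : 0ℚ ≤ ½
  0≤½ = <⇒≤ 0<½

  ½<1 : ½ < 1ℚ
  ½<1 = *<* (+<+ (ℕ.s≤s (ℕ.s≤s ℕ.z≤n)))

  ½≤1 : ½ ≤ 1ℚ
  ½≤1 = <⇒≤ ½<1

  module _ {p q r : ℚ} where

    *-monoˡ-≤ : 0ℚ ≤ r → p ≤ q → r * p ≤ r * q
    *-monoˡ-≤ 0≤r = *-monoˡ-≤-nonNeg r {{nonNegative 0≤r}}

    *-monoʳ-≤ : 0ℚ ≤ r → p ≤ q → p * r ≤ q * r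
    *-monoʳ-≤ 0≤r = *-monoʳ-≤-nonNeg r {{nonNegative 0≤r}}

    *-monoˡ-< : 0ℚ < r → p < q → r * p < r * q
    *-monoˡ-< 0<r = *-monoʳ-<-pos r {{positive 0<r}}

    *-antimonoˡ-≤ : r ≤ 0ℚ → p ≤ q → q * r ≤ p * r
    *-antimonoˡ-≤ r≤0 = *-monoʳ-≤-nonPos r {{nonPositive r≤0}}

  *-mono-≤ : ∀ {p q s t} → 0ℚ ≤ p → 0ℚ ≤ s → p ≤ q → s ≤ t → p * s ≤ q * t
  *-mono-≤ 0≤p 0≤s p≤q s≤t = ≤-trans (*-monoʳ-≤ 0≤s p≤q) (*-monoˡ-≤ (≤-trans 0≤p p≤q) s≤t)

  *-nonNeg : ∀ {p q} → 0ℚ ≤ p → 0ℚ ≤ q → 0ℚ ≤ p * q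
  *-nonNeg {p} {q} 0≤p 0≤q = subst (_≤ p * q) (*-zeroʳ p) (*-monoˡ-≤ 0≤p 0≤q)

  *-pos : ∀ {p q} → 0ℚ < p → 0ℚ < q → 0ℚ < p * q
  *-pos {p} {q} 0<p 0<q = subst (_< p * q) (*-zeroʳ p) (*-monoˡ-< 0<p 0<q)

  +-nonNeg : ∀ {p q} → 0ℚ ≤ p → 0ℚ ≤ q → 0ℚ ≤ p + q
  +-nonNeg 0≤p 0≤q = +-mono-≤ 0≤p 0≤q

  x*x-nonNeg : ∀ x → 0ℚ ≤ x * x
  x*x-nonNeg x with ≤-total 0ℚ x
  ... | inj₁ 0≤x = *-nonNeg 0≤x 0≤x
  ... | inj₂ x≤0 = subst (0ℚ ≤_) (solve 1 (λ x → (:- x) :* (:- x) := x :* x) refl x)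
                         (*-nonNeg (neg-antimono-≤ x≤0) (neg-antimono-≤ x≤0))

  module _ {p q : ℚ} where

    0≤q-p⇒p≤q : 0ℚ ≤ q - p → p ≤ q
    0≤q-p⇒p≤q h = subst₂ _≤_ (+-identityʳ p) (solve 2 (λ p q → p :+ (q :- p) := q) refl p q) (+-monoʳ-≤ p h)

    p≤q⇒0≤q-p : p ≤ q → 0ℚ ≤ q - p
    p≤q⇒0≤q-p h = subst (_≤ q - p) (+-inverseʳ p) (+-monoˡ-≤ (- p) h)

    0<q-p⇒p<q : 0ℚ < q - p → p < q
    0<q-p⇒p<q h = subst₂ _<_ (+-identityʳ p) (solve 2 (λ p q → p :+ (q :- p) := q) refl p q) (+-monoʳ-< p h)

    p<q⇒0<q-p : p < q → 0ℚ < q - p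
    p<q⇒0<q-p h = subst (_< q - p) (+-inverseʳ p) (+-monoˡ-< (- p) h)

    p-q<0⇒p<q : p - q < 0ℚ → p < q
    p-q<0⇒p<q h = 0<q-p⇒p<q (subst (0ℚ <_) (solve 2 (λ p q → :- (p :- q) := q :- p) refl p q) (neg-antimono-< h))

    -‿antimonoʳ-≤ : ∀ r → p ≤ q → r - q ≤ r - p
    -‿antimonoʳ-≤ r h = +-monoʳ-≤ r (neg-antimono-≤ h)

  0≤p⇒1-p≤1 : ∀ {p} → 0ℚ ≤ p → 1ℚ - p ≤ 1ℚ
  0≤p⇒1-p≤1 {p} 0≤p = 0≤q-p⇒p≤q (subst (0ℚ ≤_) (solve 1 (λ p → p := con 1ℚ :- (con 1ℚ :- p)) refl p) 0≤p)

  fromℕ-+ : ∀ m n → fromℕ (m ℕ.+ n) ≡ fromℕ m + fromℕ n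
  fromℕ-+ zero    n = sym (+-identityˡ (fromℕ n))
  fromℕ-+ (suc m) n = trans (cong (1ℚ +_) (fromℕ-+ m n)) (sym (+-assoc 1ℚ (fromℕ m) (fromℕ n)))

  fromℕ-* : ∀ m n → fromℕ (m ℕ.* n) ≡ fromℕ m * fromℕ n
  fromℕ-* zero    n = sym (*-zeroˡ (fromℕ n))
  fromℕ-* (suc m) n = begin
    fromℕ (n ℕ.+ m ℕ.* n)          ≡⟨ fromℕ-+ n (m ℕ.* n) ⟩
    fromℕ n + fromℕ (m ℕ.* n)      ≡⟨ cong (fromℕ n +_) (fromℕ-* m n) ⟩
    fromℕ n + fromℕ m * fromℕ n    ≡⟨ solve 2 (λ a b → b :+ a :* b := (con 1ℚ :+ a) :* b) refl (fromℕ m) (fromℕ n) ⟩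
    (1ℚ + fromℕ m) * fromℕ n       ∎
    where open ≡-Reasoning

  fromℕ-nonNeg : ∀ n → 0ℚ ≤ fromℕ n
  fromℕ-nonNeg zero    = ≤-refl
  fromℕ-nonNeg (suc n) = +-nonNeg 0≤1 (fromℕ-nonNeg n)

  1≤fromℕ-suc : ∀ n → 1ℚ ≤ fromℕ (suc n)
  1≤fromℕ-suc n = subst (_≤ fromℕ (suc n)) (+-identityʳ 1ℚ) (+-monoʳ-≤ 1ℚ (fromℕ-nonNeg n))

  fromℕ-mono-≤ : ∀ {m n} → m ℕ.≤ n → fromℕ m ≤ fromℕ n
  fromℕ-mono-≤ {m} m≤n with ℕ.m≤n⇒∃[o]m+o≡n m≤n
  ... | o , refl = subst₂ _≤_ (+-identityʳ (fromℕ m)) (sym (fromℕ-+ m o)) (+-monoʳ-≤ (fromℕ m) (fromℕ-nonNeg o))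

  ^-distribˡ-+-* : ∀ x m n → x ^ (m ℕ.+ n) ≡ x ^ m * x ^ n
  ^-distribˡ-+-* x zero    n = sym (*-identityˡ _)
  ^-distribˡ-+-* x (suc m) n = trans (cong (x *_) (^-distribˡ-+-* x m n)) (sym (*-assoc x (x ^ m) (x ^ n)))

  ^-*-assoc : ∀ x m n → (x ^ m) ^ n ≡ x ^ (m ℕ.* n)
  ^-*-assoc x m zero    = cong (x ^_) (sym (ℕ.*-zeroʳ m))
  ^-*-assoc x m (suc n) = begin
    x ^ m * (x ^ m) ^ n        ≡⟨ cong (x ^ m *_) (^-*-assoc x m n) ⟩
    x ^ m * x ^ (m ℕ.* n)      ≡⟨ sym (^-distribˡ-+-* x m (m ℕ.* n)) ⟩
    x ^ (m ℕ.+ m ℕ.* n)        ≡⟨ cong (x ^_) (sym (ℕ.*-suc m n)) ⟩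
    x ^ (m ℕ.* suc n)          ∎
    where open ≡-Reasoning

  ^-distribʳ-* : ∀ x y n → (x * y) ^ n ≡ x ^ n * y ^ n
  ^-distribʳ-* x y zero    = refl
  ^-distribʳ-* x y (suc n) = trans (cong (x * y *_) (^-distribʳ-* x y n))
    (solve 4 (λ x y a b → (x :* y) :* (a :* b) := (x :* a) :* (y :* b)) refl x y (x ^ n) (y ^ n))

  1^n≡1 : ∀ n → 1ℚ ^ n ≡ 1ℚ
  1^n≡1 zero    = refl
  1^n≡1 (suc n) = cong (1ℚ *_) (1^n≡1 n)

  module _ {x : ℚ} where

    ^-nonNeg : ∀ n → 0ℚ ≤ x → 0ℚ ≤ x ^ n
    ^-nonNeg zero    _   = 0≤1
    ^-nonNeg (suc n) 0≤x = *-nonNeg 0≤x (^-nonNeg n 0≤x)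

    ^-pos : ∀ n → 0ℚ < x → 0ℚ < x ^ n
    ^-pos zero    _   = 0<1
    ^-pos (suc n) 0<x = *-pos 0<x (^-pos n 0<x)

    ^-≤1 : ∀ n → 0ℚ ≤ x → x ≤ 1ℚ → x ^ n ≤ 1ℚ
    ^-≤1 zero    _   _   = ≤-refl
    ^-≤1 (suc n) 0≤x x≤1 = *-mono-≤ 0≤x (^-nonNeg n 0≤x) x≤1 (^-≤1 n 0≤x x≤1)

    ^-antimonoʳ-≤ : ∀ {m n} → 0ℚ ≤ x → x ≤ 1ℚ → m ℕ.≤ n → x ^ n ≤ x ^ m
    ^-antimonoʳ-≤ {m} 0≤x x≤1 m≤n with ℕ.m≤n⇒∃[o]m+o≡n m≤n
    ... | o , refl = subst₂ _≤_ (sym (^-distribˡ-+-* x m o)) (*-identityʳ (x ^ m))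
                            (*-monoˡ-≤ (^-nonNeg m 0≤x) (^-≤1 o 0≤x x≤1))

  ^-monoˡ-≤ : ∀ {x y} n → 0ℚ ≤ x → x ≤ y → x ^ n ≤ y ^ n
  ^-monoˡ-≤ zero    _   _   = ≤-refl
  ^-monoˡ-≤ (suc n) 0≤x x≤y = *-mono-≤ 0≤x (^-nonNeg n 0≤x) x≤y (^-monoˡ-≤ n 0≤x x≤y)

  open ≤-Reasoning

  module _ {x : ℚ} (0≤x : 0ℚ ≤ x) (x≤1 : x ≤ 1ℚ) where

    bernoulli : ∀ n → 1ℚ - fromℕ n * x ≤ (1ℚ - x) ^ n
    bernoulli zero    = ≤-reflexive (solve 1 (λ x → con 1ℚ :- con 0ℚ :* x := con 1ℚ) refl x)
    bernoulli (suc n) = begin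
      1ℚ - (1ℚ + fromℕ n) * x          ≤⟨ 0≤q-p⇒p≤q (subst (0ℚ ≤_) step (*-nonNeg (fromℕ-nonNeg n) (x*x-nonNeg x))) ⟩
      (1ℚ - x) * (1ℚ - fromℕ n * x)    ≤⟨ *-monoˡ-≤ (p≤q⇒0≤q-p x≤1) (bernoulli n) ⟩
      (1ℚ - x) * (1ℚ - x) ^ n          ∎
      where
      step : fromℕ n * (x * x) ≡ (1ℚ - x) * (1ℚ - fromℕ n * x) - (1ℚ - (1ℚ + fromℕ n) * x)
      step = solve 2 (λ x m → m :* (x :* x) := (con 1ℚ :- x) :* (con 1ℚ :- m :* x) :- (con 1ℚ :- (con 1ℚ :+ m) :* x)) refl x (fromℕ n)

    bernoulli-reciprocal : ∀ n → (1ℚ - x) ^ n * (1ℚ + fromℕ n * x) ≤ 1ℚ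
    bernoulli-reciprocal zero    = ≤-reflexive (solve 1 (λ x → con 1ℚ :* (con 1ℚ :+ con 0ℚ :* x) := con 1ℚ) refl x)
    bernoulli-reciprocal (suc n) = begin
      (1ℚ - x) * Q * (1ℚ + (1ℚ + m) * x)
        ≡⟨ solve 3 (λ x Q m → (con 1ℚ :- x) :* Q :* (con 1ℚ :+ (con 1ℚ :+ m) :* x) := Q :* ((con 1ℚ :- x) :* (con 1ℚ :+ (con 1ℚ :+ m) :* x))) refl x Q m ⟩
      Q * ((1ℚ - x) * (1ℚ + (1ℚ + m) * x))
        ≤⟨ *-monoˡ-≤ (^-nonNeg n (p≤q⇒0≤q-p x≤1)) (0≤q-p⇒p≤q (subst (0ℚ ≤_) step (*-nonNeg (fromℕ-nonNeg (suc n)) (x*x-nonNeg x)))) ⟩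
      Q * (1ℚ + m * x)
        ≤⟨ bernoulli-reciprocal n ⟩
      1ℚ ∎
      where
      Q = (1ℚ - x) ^ n
      m = fromℕ n
      step : (1ℚ + m) * (x * x) ≡ (1ℚ + m * x) - (1ℚ - x) * (1ℚ + (1ℚ + m) * x)
      step = solve 2 (λ x m → (con 1ℚ :+ m) :* (x :* x) := (con 1ℚ :+ m :* x) :- (con 1ℚ :- x) :* (con 1ℚ :+ (con 1ℚ :+ m) :* x)) refl x m

  module _ {u v : ℚ} (0≤v : 0ℚ ≤ v) (v≤u : v ≤ u) where

    ^-increment-lower : ∀ n → fromℕ (suc n) * v ^ n * (u - v) ≤ u ^ suc n - v ^ suc n
    ^-increment-lower zero    = ≤-reflexive (solve 2 (λ u v → (con 1ℚ :+ con 0ℚ) :* con 1ℚ :* (u :- v) := u :* con 1ℚ :- v :* con 1ℚ) refl u v)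
    ^-increment-lower (suc n) = begin
      (1ℚ + (1ℚ + fromℕ n)) * (v * v ^ n) * (u - v)
        ≡⟨ solve 4 (λ u v V m → (con 1ℚ :+ (con 1ℚ :+ m)) :* (v :* V) :* (u :- v) := v :* ((con 1ℚ :+ m) :* V :* (u :- v)) :+ (v :* V) :* (u :- v)) refl u v (v ^ n) (fromℕ n) ⟩
      v * (fromℕ (suc n) * v ^ n * (u - v)) + (v * v ^ n) * (u - v)
        ≤⟨ +-monoˡ-≤ _ (*-monoʳ-≤ (*-nonNeg (*-nonNeg (fromℕ-nonNeg (suc n)) (^-nonNeg n 0≤v)) (p≤q⇒0≤q-p v≤u)) v≤u) ⟩
      u * (fromℕ (suc n) * v ^ n * (u - v)) + (v * v ^ n) * (u - v)
        ≤⟨ +-monoˡ-≤ _ (*-monoˡ-≤ (≤-trans 0≤v v≤u) (^-increment-lower n)) ⟩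
      u * (u ^ suc n - v ^ suc n) + (v * v ^ n) * (u - v)
        ≡⟨ solve 4 (λ u v U V → u :* (u :* U :- v :* V) :+ (v :* V) :* (u :- v) := u :* (u :* U) :- v :* (v :* V)) refl u v (u ^ n) (v ^ n) ⟩
      u ^ suc (suc n) - v ^ suc (suc n) ∎

    ^-increment-upper : ∀ n → u ^ suc n - v ^ suc n ≤ fromℕ (suc n) * u ^ n * (u - v)
    ^-increment-upper zero    = ≤-reflexive (solve 2 (λ u v → u :* con 1ℚ :- v :* con 1ℚ := (con 1ℚ :+ con 0ℚ) :* con 1ℚ :* (u :- v)) refl u v)
    ^-increment-upper (suc n) = begin
      u ^ suc (suc n) - v ^ suc (suc n)
        ≡⟨ solve 4 (λ u v U V → u :* (u :* U) :- v :* (v :* V) := v :* (u :* U :- v :* V) :+ (u :* U) :* (u :- v)) refl u v (u ^ n) (v ^ n) ⟩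
      v * (u ^ suc n - v ^ suc n) + (u * u ^ n) * (u - v)
        ≤⟨ +-monoˡ-≤ _ (*-monoˡ-≤ 0≤v (^-increment-upper n)) ⟩
      v * (fromℕ (suc n) * u ^ n * (u - v)) + (u * u ^ n) * (u - v)
        ≤⟨ +-monoˡ-≤ _ (*-monoʳ-≤ (*-nonNeg (*-nonNeg (fromℕ-nonNeg (suc n)) (^-nonNeg n (≤-trans 0≤v v≤u))) (p≤q⇒0≤q-p v≤u)) v≤u) ⟩
      u * (fromℕ (suc n) * u ^ n * (u - v)) + (u * u ^ n) * (u - v)
        ≡⟨ solve 4 (λ u v U m → u :* ((con 1ℚ :+ m) :* U :* (u :- v)) :+ (u :* U) :* (u :- v) := (con 1ℚ :+ (con 1ℚ :+ m)) :* (u :* U) :* (u :- v)) refl u v (u ^ n) (fromℕ n) ⟩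
      (1ℚ + (1ℚ + fromℕ n)) * (u * u ^ n) * (u - v) ∎

module Dyadic where

  open import Defs using (_^_)
  open RationalArithmetic
  open import Data.Nat as ℕ using (ℕ; zero; suc)
  import Data.Nat.Properties as ℕ
  open import Data.Rational using (0ℚ; 1ℚ; ½; _+_; _*_; _-_; _<_; _≤_; positive)
  open import Data.Rational.Properties
  open import Data.Rational.Solver using (module +-*-Solver)
  open import Relation.Binary.PropositionalEquality

  open +-*-Solver

  2^_ : ℕ → ℕ
  2^ e = 2 ℕ.^ e

  2^-mono-≤ : ∀ {a b} → a ℕ.≤ b → 2^ a ℕ.≤ 2^ b
  2^-mono-≤ = ℕ.^-monoʳ-≤ 2

  n<2^n : ∀ n → n ℕ.< 2^ n
  n<2^n zero    = ℕ.s≤s ℕ.z≤n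
  n<2^n (suc n) = ℕ.+-mono-≤-< (ℕ.m^n>0 2 n) (ℕ.≤-trans (n<2^n n) (ℕ.m≤m+n (2^ n) 0))

  ½^-pos : ∀ e → 0ℚ < ½ ^ e
  ½^-pos e = ^-pos e 0<½

  ½^-nonNeg : ∀ e → 0ℚ ≤ ½ ^ e
  ½^-nonNeg e = <⇒≤ (½^-pos e)

  ½^-≤1 : ∀ e → ½ ^ e ≤ 1ℚ
  ½^-≤1 e = ^-≤1 e 0≤½ ½≤1

  ½^-antimono-≤ : ∀ {a b} → a ℕ.≤ b → ½ ^ b ≤ ½ ^ a
  ½^-antimono-≤ = ^-antimonoʳ-≤ 0≤½ ½≤1

  ½^-suc< : ∀ e → ½ ^ suc e < ½ ^ e
  ½^-suc< e = subst (½ ^ suc e <_) (*-identityˡ (½ ^ e)) (*-monoˡ-<-pos (½ ^ e) {{positive (½^-pos e)}} ½<1)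

  ½^-antimono-< : ∀ {a b} → a ℕ.< b → ½ ^ b < ½ ^ a
  ½^-antimono-< {b = suc b} (ℕ.s≤s a≤b) = <-≤-trans (½^-suc< b) (½^-antimono-≤ a≤b)

  ½^suc+½^suc : ∀ e → ½ ^ suc e + ½ ^ suc e ≡ ½ ^ e
  ½^suc+½^suc e = solve 1 (λ h → con ½ :* h :+ con ½ :* h := h) refl (½ ^ e)

  2^*½^ : ∀ e → fromℕ (2^ e) * ½ ^ e ≡ 1ℚ
  2^*½^ zero    = refl
  2^*½^ (suc e) = begin
    fromℕ (2 ℕ.* 2^ e) * (½ * ½ ^ e)
      ≡⟨ cong (_* (½ * ½ ^ e)) (fromℕ-* 2 (2^ e)) ⟩
    fromℕ 2 * fromℕ (2^ e) * (½ * ½ ^ e)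
      ≡⟨ solve 3 (λ n h H → con (fromℕ 2) :* n :* (h :* H) := (con (fromℕ 2) :* h) :* (n :* H)) refl (fromℕ (2^ e)) ½ (½ ^ e) ⟩
    (fromℕ 2 * ½) * (fromℕ (2^ e) * ½ ^ e)
      ≡⟨ cong (fromℕ 2 * ½ *_) (2^*½^ e) ⟩
    1ℚ ∎
    where open ≡-Reasoning

  2^*½^suc : ∀ e → fromℕ (2^ e) * ½ ^ suc e ≡ ½
  2^*½^suc e = begin
    fromℕ (2^ e) * (½ * ½ ^ e)    ≡⟨ solve 3 (λ n h H → n :* (h :* H) := h :* (n :* H)) refl (fromℕ (2^ e)) ½ (½ ^ e) ⟩
    ½ * (fromℕ (2^ e) * ½ ^ e)    ≡⟨ cong (½ *_) (2^*½^ e) ⟩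
    ½                             ∎
    where open ≡-Reasoning

  2^+*½^ : ∀ a b → fromℕ (2^ (a ℕ.+ b)) * ½ ^ a ≡ fromℕ (2^ b)
  2^+*½^ a b = begin
    fromℕ (2^ (a ℕ.+ b)) * ½ ^ a             ≡⟨ cong (λ n → fromℕ n * ½ ^ a) (ℕ.^-distribˡ-+-* 2 a b) ⟩
    fromℕ (2^ a ℕ.* 2^ b) * ½ ^ a            ≡⟨ cong (_* ½ ^ a) (fromℕ-* (2^ a) (2^ b)) ⟩
    fromℕ (2^ a) * fromℕ (2^ b) * ½ ^ a      ≡⟨ solve 3 (λ x y h → x :* y :* h := (x :* h) :* y) refl (fromℕ (2^ a)) (fromℕ (2^ b)) (½ ^ a) ⟩
    (fromℕ (2^ a) * ½ ^ a) * fromℕ (2^ b)    ≡⟨ cong (_* fromℕ (2^ b)) (2^*½^ a) ⟩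
    1ℚ * fromℕ (2^ b)                        ≡⟨ *-identityˡ _ ⟩
    fromℕ (2^ b)                             ∎
    where open ≡-Reasoning

  open ≤-Reasoning

  decay-½ : ∀ e {x} → ½ ^ e ≤ x → x ≤ 1ℚ → (1ℚ - x) ^ 2^ e ≤ ½
  decay-½ e {x} ½^e≤x x≤1 = begin
    A                          ≡⟨ solve 1 (λ A → A := (A :+ A) :* con ½) refl A ⟩
    (A + A) * ½                ≤⟨ *-monoʳ-≤ 0≤½ A+A≤1 ⟩
    1ℚ * ½                     ≡⟨ *-identityˡ ½ ⟩
    ½                          ∎
    where
    A = (1ℚ - x) ^ 2^ e
    1≤2^e*x : 1ℚ ≤ fromℕ (2^ e) * x
    1≤2^e*x = ≤-trans (≤-reflexive (sym (2^*½^ e))) (*-monoˡ-≤ (fromℕ-nonNeg (2^ e)) ½^e≤x)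
    A+A≤1 : A + A ≤ 1ℚ
    A+A≤1 = begin
      A + A                           ≡⟨ solve 1 (λ A → A :+ A := A :* (con 1ℚ :+ con 1ℚ)) refl A ⟩
      A * (1ℚ + 1ℚ)                   ≤⟨ *-monoˡ-≤ (^-nonNeg (2^ e) (p≤q⇒0≤q-p x≤1)) (+-monoʳ-≤ 1ℚ 1≤2^e*x) ⟩
      A * (1ℚ + fromℕ (2^ e) * x)     ≤⟨ bernoulli-reciprocal (≤-trans (½^-nonNeg e) ½^e≤x) x≤1 (2^ e) ⟩
      1ℚ                              ∎

  decay-upper : ∀ e f E {x} → e ℕ.+ f ℕ.≤ E → ½ ^ e ≤ x → x ≤ 1ℚ → (1ℚ - x) ^ 2^ E ≤ ½ ^ 2^ f
  decay-upper e f E {x} e+f≤E ½^e≤x x≤1 = begin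
    (1ℚ - x) ^ 2^ E                  ≤⟨ ^-antimonoʳ-≤ 0≤1-x (0≤p⇒1-p≤1 0≤x) (2^-mono-≤ e+f≤E) ⟩
    (1ℚ - x) ^ 2^ (e ℕ.+ f)          ≡⟨ cong ((1ℚ - x) ^_) (ℕ.^-distribˡ-+-* 2 e f) ⟩
    (1ℚ - x) ^ (2^ e ℕ.* 2^ f)       ≡⟨ sym (^-*-assoc (1ℚ - x) (2^ e) (2^ f)) ⟩
    ((1ℚ - x) ^ 2^ e) ^ 2^ f         ≤⟨ ^-monoˡ-≤ (2^ f) (^-nonNeg (2^ e) 0≤1-x) (decay-½ e ½^e≤x x≤1) ⟩
    ½ ^ 2^ f                         ∎
    where
    0≤x = ≤-trans (½^-nonNeg e) ½^e≤x
    0≤1-x = p≤q⇒0≤q-p x≤1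

  decay-lower : ∀ e f E → E ℕ.≤ e ℕ.+ f → ½ ^ 2^ f ≤ (1ℚ - ½ ^ suc e) ^ 2^ E
  decay-lower e f E E≤e+f = begin
    ½ ^ 2^ f
      ≡⟨ cong (λ y → (1ℚ - y) ^ 2^ f) (sym (2^*½^suc e)) ⟩
    (1ℚ - fromℕ (2^ e) * ½ ^ suc e) ^ 2^ f
      ≤⟨ ^-monoˡ-≤ (2^ f) (p≤q⇒0≤q-p (≤-trans (≤-reflexive (2^*½^suc e)) ½≤1)) (bernoulli (½^-nonNeg (suc e)) (½^-≤1 (suc e)) (2^ e)) ⟩
    ((1ℚ - ½ ^ suc e) ^ 2^ e) ^ 2^ f
      ≡⟨ ^-*-assoc (1ℚ - ½ ^ suc e) (2^ e) (2^ f) ⟩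
    (1ℚ - ½ ^ suc e) ^ (2^ e ℕ.* 2^ f)
      ≡⟨ cong ((1ℚ - ½ ^ suc e) ^_) (sym (ℕ.^-distribˡ-+-* 2 e f)) ⟩
    (1ℚ - ½ ^ suc e) ^ 2^ (e ℕ.+ f)
      ≤⟨ ^-antimonoʳ-≤ (p≤q⇒0≤q-p (½^-≤1 (suc e))) (0≤p⇒1-p≤1 (½^-nonNeg (suc e))) (2^-mono-≤ E≤e+f) ⟩
    (1ℚ - ½ ^ suc e) ^ 2^ E ∎

module DecreasingIntervals where

  open import Defs using (IsInterval; DecreasingOn; MaxDecInterval; AtLeastDecIntervals)
  open import Data.Nat as ℕ using (ℕ; suc)
  import Data.Nat.Properties as ℕ
  open import Data.Fin using (toℕ)
  open import Data.Fin.Properties using (toℕ<n; toℕ-injective)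
  open import Data.Rational using (ℚ; 0ℚ; 1ℚ; _<_; _≤_)
  open import Data.Rational.Properties
  open import Data.Product using (Σ; _×_; _,_; proj₁; proj₂)
  open import Data.Sum using (_⊎_; inj₁; inj₂)
  open import Data.Empty using (⊥; ⊥-elim)
  open import Relation.Nullary using (Dec; yes; no; ¬_)
  open import Relation.Binary.PropositionalEquality
  open import Relation.Binary.Definitions using (tri<; tri≈; tri>)

  DecreasingOnSegment : (ℚ → ℚ) → ℚ → ℚ → Set
  DecreasingOnSegment f a b = ∀ x y → a ≤ x → y ≤ b → x < y → f y < f x

  ≤⇒<⊎≡ : ∀ {x y : ℚ} → x ≤ y → x < y ⊎ x ≡ y
  ≤⇒<⊎≡ {x} {y} x≤y with <-cmp x y
  ... | tri< x<y _ _ = inj₁ x<y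
  ... | tri≈ _ x≡y _ = inj₂ x≡y
  ... | tri> _ _ y<x = ⊥-elim (<-irrefl refl (<-≤-trans y<x x≤y))

  module _ (f : ℚ → ℚ) where

    DecreasingComponent : ℚ → ℚ → Set
    DecreasingComponent c x =
      Σ ℚ λ a → Σ ℚ λ b → 0ℚ < a × b < 1ℚ × a ≤ x × x ≤ b × a ≤ c × c ≤ b × DecreasingOnSegment f a b

    decreasing-∪ : ∀ {a b a′ b′ c} → DecreasingOnSegment f a b → DecreasingOnSegment f a′ b′ →
                   a ≤ c → c ≤ b → a′ ≤ c → c ≤ b′ →
                   ∀ x y → (a ≤ x × x ≤ b) ⊎ (a′ ≤ x × x ≤ b′) → (a ≤ y × y ≤ b) ⊎ (a′ ≤ y × y ≤ b′) →
                   x < y → f y < f x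
    decreasing-∪ d d′ _ _ _ _ x y (inj₁ (a≤x , _)) (inj₁ (_ , y≤b)) = d x y a≤x y≤b
    decreasing-∪ d d′ _ _ _ _ x y (inj₂ (a≤x , _)) (inj₂ (_ , y≤b)) = d′ x y a≤x y≤b
    decreasing-∪ {c = c} d d′ a≤c c≤b a′≤c c≤b′ x y (inj₁ (a≤x , _)) (inj₂ (_ , y≤b′)) x<y
      with c ≤? x | y ≤? c
    ... | yes c≤x | _     = d′ x y (≤-trans a′≤c c≤x) y≤b′ x<y
    ... | no _    | yes y≤c = d x y a≤x (≤-trans y≤c c≤b) x<y
    ... | no c≰x  | no y≰c  = <-trans (d′ c y a′≤c y≤b′ (≰⇒> y≰c)) (d x c a≤x c≤b (≰⇒> c≰x))
    decreasing-∪ {c = c} d d′ a≤c c≤b a′≤c c≤b′ x y (inj₂ (a′≤x , _)) (inj₁ (_ , y≤b)) x<y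
      with c ≤? x | y ≤? c
    ... | yes c≤x | _     = d x y (≤-trans a≤c c≤x) y≤b x<y
    ... | no _    | yes y≤c = d′ x y a′≤x (≤-trans y≤c c≤b′) x<y
    ... | no c≰x  | no y≰c  = <-trans (d c y a≤c y≤b (≰⇒> y≰c)) (d′ x c a′≤x c≤b′ (≰⇒> c≰x))

    component-decreasing : ∀ c → DecreasingOn f (DecreasingComponent c)
    component-decreasing c x y (a , b , _ , _ , a≤x , x≤b , a≤c , c≤b , d) (a′ , b′ , _ , _ , a′≤y , y≤b′ , a′≤c , c≤b′ , d′) =
      decreasing-∪ d d′ a≤c c≤b a′≤c c≤b′ x y (inj₁ (a≤x , x≤b)) (inj₂ (a′≤y , y≤b′))

    component-convex : ∀ c x y z → DecreasingComponent c x → DecreasingComponent c z → x < y → y < z → DecreasingComponent c y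
    component-convex c x y z (a , b , 0<a , b<1 , a≤x , x≤b , a≤c , c≤b , d) (a′ , b′ , 0<a′ , b′<1 , a′≤z , z≤b′ , a′≤c , c≤b′ , d′) x<y y<z
      with y ≤? c
    ... | yes y≤c = a , b , 0<a , b<1 , ≤-trans a≤x (<⇒≤ x<y) , ≤-trans y≤c c≤b , a≤c , c≤b , d
    ... | no y≰c  = a′ , b′ , 0<a′ , b′<1 , ≤-trans a′≤c (<⇒≤ (≰⇒> y≰c)) , ≤-trans (<⇒≤ y<z) z≤b′ , a′≤c , c≤b′ , d′

    segment-⊆-component : ∀ {a b} → 0ℚ < a → b < 1ℚ → DecreasingOnSegment f a b →
                          ∀ x → a ≤ x → x ≤ b → DecreasingComponent a x
    segment-⊆-component {a} {b} 0<a b<1 d x a≤x x≤b = a , b , 0<a , b<1 , a≤x , x≤b , ≤-refl , ≤-trans a≤x x≤b , d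

    component-isInterval : ∀ {a b} → 0ℚ < a → a < b → b < 1ℚ → DecreasingOnSegment f a b → IsInterval (DecreasingComponent a)
    component-isInterval {a} {b} 0<a a<b b<1 d = bounds , component-convex a , a , b , ∈a , ∈b , a<b
      where
      bounds : ∀ x → DecreasingComponent a x → 0ℚ < x × x < 1ℚ
      bounds x (a′ , b′ , 0<a′ , b′<1 , a′≤x , x≤b′ , _) = <-≤-trans 0<a′ a′≤x , ≤-<-trans x≤b′ b′<1
      ∈a = segment-⊆-component 0<a b<1 d a ≤-refl (<⇒≤ a<b)
      ∈b = segment-⊆-component 0<a b<1 d b (<⇒≤ a<b) ≤-refl

    -- Each x ∈ J lies in the segment [x, c] or [c, x], which J contains and on which f decreases.
    component-maximal : ∀ {c} → DecreasingComponent c c → ∀ J → IsInterval J → DecreasingOn f J →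
                        (∀ x → DecreasingComponent c x → J x) → ∀ x → J x → DecreasingComponent c x
    component-maximal {c} c∈C J (J-bounds , J-convex , _) J-decreasing C⊆J x x∈J = cover (x ≤? c)
      where
      c∈J = C⊆J c c∈C
      segment-⊆-J : ∀ {u w} → J u → J w → ∀ z → u ≤ z → z ≤ w → J z
      segment-⊆-J u∈J w∈J z u≤z z≤w with ≤⇒<⊎≡ u≤z | ≤⇒<⊎≡ z≤w
      ... | inj₂ refl | _        = u∈J
      ... | inj₁ _    | inj₂ refl = w∈J
      ... | inj₁ u<z  | inj₁ z<w  = J-convex _ z _ u∈J w∈J u<z z<w
      J-segment : ∀ {u w} → u ≤ w → J u → J w → DecreasingOnSegment f u w
      J-segment u≤w u∈J w∈J y z u≤y z≤w y<z =
        J-decreasing y z (segment-⊆-J u∈J w∈J y u≤y (≤-trans (<⇒≤ y<z) z≤w))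
                         (segment-⊆-J u∈J w∈J z (≤-trans u≤y (<⇒≤ y<z)) z≤w) y<z
      cover : Dec (x ≤ c) → DecreasingComponent c x
      cover (yes x≤c) = x , c , proj₁ (J-bounds x x∈J) , proj₂ (J-bounds c c∈J) , ≤-refl , x≤c , x≤c , ≤-refl , J-segment x≤c x∈J c∈J
      cover (no x≰c)  = c , x , proj₁ (J-bounds c c∈J) , proj₂ (J-bounds x x∈J) , c≤x , ≤-refl , ≤-refl , c≤x , J-segment c≤x c∈J x∈J
        where c≤x = <⇒≤ (≰⇒> x≰c)

    components-disjoint : ∀ {c c′ u v} → c ≤ u → u < v → v ≤ c′ → f u < f v →
                          ∀ x → DecreasingComponent c x → DecreasingComponent c′ x → ⊥
    components-disjoint {c} {c′} {u} {v} c≤u u<v v≤c′ fu<fv x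
      (a , b , _ , _ , a≤x , x≤b , a≤c , c≤b , d) (a′ , b′ , _ , _ , a′≤x , x≤b′ , a′≤c′ , c′≤b′ , d′) =
      <-asym fu<fv (decreasing-∪ d d′ a≤x x≤b a′≤x x≤b′ u v (covered u c≤u (≤-trans (<⇒≤ u<v) v≤c′))
                                                          (covered v (≤-trans c≤u (<⇒≤ u<v)) v≤c′) u<v)
      where
      covered : ∀ z → c ≤ z → z ≤ c′ → (a ≤ z × z ≤ b) ⊎ (a′ ≤ z × z ≤ b′)
      covered z c≤z z≤c′ with z ≤? x
      ... | yes z≤x = inj₁ (≤-trans a≤c c≤z , ≤-trans z≤x x≤b)
      ... | no z≰x  = inj₂ (≤-trans a′≤x (<⇒≤ (≰⇒> z≰x)) , ≤-trans z≤c′ c′≤b′)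
  DecreasingOnSegment-cong : ∀ {g h : ℚ → ℚ} {a b} → (∀ p → g p ≡ h p) → DecreasingOnSegment g a b → DecreasingOnSegment h a b
  DecreasingOnSegment-cong g≗h d x y a≤x y≤b x<y = subst₂ _<_ (g≗h y) (g≗h x) (d x y a≤x y≤b x<y)

  record SeparatedDecreasingSegments (K : ℕ) (f : ℚ → ℚ) : Set where
    field
      lo hi s t   : ℕ → ℚ
      0<lo        : ∀ i → i ℕ.< K → 0ℚ < lo i
      lo<hi       : ∀ i → i ℕ.< K → lo i < hi i
      hi<1        : ∀ i → i ℕ.< K → hi i < 1ℚ
      decreasing  : ∀ i → i ℕ.< K → DecreasingOnSegment f (lo i) (hi i)
      hi≤s        : ∀ i → suc i ℕ.< K → hi i ≤ s i
      s<t         : ∀ i → suc i ℕ.< K → s i < t i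
      t≤lo        : ∀ i → suc i ℕ.< K → t i ≤ lo (suc i)
      rises       : ∀ i → suc i ℕ.< K → f (s i) < f (t i)

  module _ {K : ℕ} {f : ℚ → ℚ} (W : SeparatedDecreasingSegments K f) where
    open SeparatedDecreasingSegments W

    lo-suc : ∀ i → suc i ℕ.< K → lo i ≤ lo (suc i)
    lo-suc i 1+i<K = ≤-trans (<⇒≤ (lo<hi i (ℕ.<-trans (ℕ.n<1+n i) 1+i<K)))
                       (≤-trans (hi≤s i 1+i<K) (≤-trans (<⇒≤ (s<t i 1+i<K)) (t≤lo i 1+i<K)))

    lo-mono : ∀ i d → i ℕ.+ d ℕ.< K → lo i ≤ lo (i ℕ.+ d)
    lo-mono i ℕ.zero    _ = ≤-reflexive (cong lo (sym (ℕ.+-identityʳ i)))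
    lo-mono i (suc d) i+1+d<K rewrite ℕ.+-suc i d =
      ≤-trans (lo-mono i d (ℕ.<-trans (ℕ.n<1+n _) i+1+d<K)) (lo-suc (i ℕ.+ d) i+1+d<K)

    rise-between : ∀ i j → i ℕ.< j → j ℕ.< K → Σ ℚ λ u → Σ ℚ λ v → lo i ≤ u × u < v × v ≤ lo j × f u < f v
    rise-between i j i<j j<K with ℕ.m≤n⇒∃[o]m+o≡n i<j
    ... | d , refl = s i , t i , ≤-trans (<⇒≤ (lo<hi i (ℕ.<-trans i<j j<K))) (hi≤s i 1+i<K) , s<t i 1+i<K ,
                     ≤-trans (t≤lo i 1+i<K) (lo-mono (suc i) d j<K) , rises i 1+i<K
      where 1+i<K = ℕ.≤-<-trans i<j j<K

    component-maxDecInterval : ∀ i → i ℕ.< K → MaxDecInterval f (DecreasingComponent f (lo i))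
    component-maxDecInterval i i<K =
      interval , component-decreasing f (lo i) ,
      component-maximal f (segment-⊆-component f (0<lo i i<K) (hi<1 i i<K) (decreasing i i<K) (lo i) ≤-refl (<⇒≤ (lo<hi i i<K)))
      where interval = component-isInterval f (0<lo i i<K) (lo<hi i i<K) (hi<1 i i<K) (decreasing i i<K)

    separated⇒atLeastDecIntervals : AtLeastDecIntervals K f
    separated⇒atLeastDecIntervals =
      (λ i → DecreasingComponent f (lo (toℕ i))) , (λ i → component-maxDecInterval (toℕ i) (toℕ<n i)) , disjoint
      where
      disjoint : ∀ i j → ¬ i ≡ j → ∀ x → DecreasingComponent f (lo (toℕ i)) x → DecreasingComponent f (lo (toℕ j)) x → ⊥
      disjoint i j i≢j x x∈i x∈j with ℕ.<-cmp (toℕ i) (toℕ j)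
      ... | tri< i<j _ _ = let (u , v , lo≤u , u<v , v≤lo , fu<fv) = rise-between (toℕ i) (toℕ j) i<j (toℕ<n j)
                           in components-disjoint f lo≤u u<v v≤lo fu<fv x x∈i x∈j
      ... | tri≈ _ i≡j _ = i≢j (toℕ-injective i≡j)
      ... | tri> _ _ j<i = let (u , v , lo≤u , u<v , v≤lo , fu<fv) = rise-between (toℕ j) (toℕ i) j<i (toℕ<n i)
                           in components-disjoint f lo≤u u<v v≤lo fu<fv x x∈j x∈i

module Reachability where

  open import Defs hiding (sym)
  open import Data.Bool using (Bool; true; false; _∧_; _∨_; not)
  open import Data.Bool.Properties using (∨-zeroʳ; ∧-zeroʳ)
  open import Data.Bool.ListAction using (any; all)
  open import Data.Nat as ℕ using (ℕ; zero; suc)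
  import Data.Nat.Properties as ℕ
  open import Data.Fin as Fin using (Fin)
  open import Data.List using ([]; _∷_; allFin)
  open import Data.List.Relation.Unary.Any using (here; there)
  open import Data.List.Membership.Propositional using (_∈_)
  open import Data.List.Membership.Propositional.Properties using (∈-allFin)
  open import Data.Fin.Subset using (Subset)
  open import Data.Sum using (_⊎_; inj₁; inj₂)
  open import Data.Product using (_×_; _,_)
  open import Relation.Nullary using (¬_; yes; no; contradiction)
  open import Relation.Binary.PropositionalEquality

  module _ {A : Set} (f : A → Bool) where

    any-≡true : ∀ {xs x} → x ∈ xs → f x ≡ true → any f xs ≡ true
    any-≡true {x ∷ xs} (here refl) fx = cong (_∨ any f xs) fx
    any-≡true {y ∷ xs} (there x∈xs) fx = trans (cong (f y ∨_) (any-≡true x∈xs fx)) (∨-zeroʳ (f y))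

    any-≡false : ∀ xs → (∀ x → f x ≡ false) → any f xs ≡ false
    any-≡false []       _  = refl
    any-≡false (x ∷ xs) fx = trans (cong (_∨ any f xs) (fx x)) (any-≡false xs fx)

    all-≡true : ∀ xs → (∀ x → f x ≡ true) → all f xs ≡ true
    all-≡true []       _  = refl
    all-≡true (x ∷ xs) fx = trans (cong (_∧ all f xs) (fx x)) (all-≡true xs fx)

    all-≡false : ∀ {xs x} → x ∈ xs → f x ≡ false → all f xs ≡ false
    all-≡false {x ∷ xs} (here refl) fx = cong (_∧ all f xs) fx
    all-≡false {y ∷ xs} (there x∈xs) fx = trans (cong (f y ∧_) (all-≡false x∈xs fx)) (∧-zeroʳ (f y))

  module _ (G : Graph) (S : Subset (n G)) where

    Reach : ℕ → Fin (n G) → Fin (n G) → Set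
    Reach m u v = reachW G S m u v ≡ true

    Step : Fin (n G) → Fin (n G) → Set
    Step u w = u ≡ w ⊎ (adj G u w ≡ true × mem w S ≡ true)

    reach-refl : ∀ u → Reach 0 u u
    reach-refl u with u Fin.≟ u
    ... | yes _   = refl
    ... | no u≢u = contradiction refl u≢u

    reach₀-≢ : ∀ {u v} → ¬ u ≡ v → reachW G S 0 u v ≡ false
    reach₀-≢ {u} {v} u≢v with u Fin.≟ v
    ... | yes u≡v = contradiction u≡v u≢v
    ... | no _    = refl

    reach-suc : ∀ m {u v} → Reach m u v → Reach (suc m) u v
    reach-suc m {u} {v} r = cong (_∨ any (λ w → mem w S ∧ adj G u w ∧ reachW G S m w v) (allFin (n G))) r

    reach-mono : ∀ {m m′ u v} → m ℕ.≤ m′ → Reach m u v → Reach m′ u v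
    reach-mono {m} {u = u} {v} m≤m′ r with ℕ.m≤n⇒∃[o]m+o≡n m≤m′
    ... | o , refl = extend o
      where
      extend : ∀ o → Reach (m ℕ.+ o) u v
      extend zero    = subst (λ k → Reach k u v) (sym (ℕ.+-identityʳ m)) r
      extend (suc o) = subst (λ k → Reach k u v) (sym (ℕ.+-suc m o)) (reach-suc (m ℕ.+ o) (extend o))

    reach-step : ∀ m {u w v} → Step u w → Reach m w v → Reach (suc m) u v
    reach-step m (inj₁ refl) r = reach-suc m r
    reach-step m {u} {w} {v} (inj₂ (uw , w∈S)) r =
      trans (cong (reachW G S m u v ∨_) (any-≡true _ (∈-allFin w) step)) (∨-zeroʳ (reachW G S m u v))
      where
      step : (mem w S ∧ adj G u w ∧ reachW G S m w v) ≡ true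
      step rewrite w∈S | uw | r = refl

    connected-intro : (∀ u v → mem u S ≡ true → mem v S ≡ true → Reach (n G) u v) → inducedConnected G S ≡ true
    connected-intro reach = all-≡true _ (allFin (n G)) λ u → all-≡true _ (allFin (n G)) λ v → pair u v
      where
      pair : ∀ u v → (not (mem u S ∧ mem v S) ∨ reachW G S (n G) u v) ≡ true
      pair u v with mem u S in u∈S | mem v S in v∈S
      ... | false | _     = refl
      ... | true  | false = refl
      ... | true  | true  = reach u v u∈S v∈S

    connected-elim : ∀ u v → mem u S ≡ true → mem v S ≡ true → reachW G S (n G) u v ≡ false → inducedConnected G S ≡ false
    connected-elim u v u∈S v∈S ¬uv = all-≡false _ (∈-allFin u) (all-≡false _ (∈-allFin v) pair)
      where
      pair : (not (mem u S ∧ mem v S) ∨ reachW G S (n G) u v) ≡ false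
      pair rewrite u∈S | v∈S | ¬uv = refl

module Subsets where

  open import Defs using (nonemptyB)
  open import Data.Bool using (Bool; true; false; not)
  open import Data.Nat as ℕ using (zero; suc)
  import Data.Nat.Properties as ℕ
  open import Data.Fin using (Fin; zero; suc)
  open import Data.Fin.Properties using (suc-injective)
  open import Data.Fin.Subset using (Subset; ∣_∣)
  open import Data.Vec using ([]; _∷_; _++_; lookup)
  open import Data.Product using (Σ; _×_; _,_)
  open import Relation.Nullary using (¬_; contradiction)
  open import Relation.Binary.PropositionalEquality

  isEmpty : ∀ {n} → Subset n → Bool
  isEmpty S = ∣ S ∣ ℕ.≡ᵇ 0

  isSingleton : ∀ {n} → Subset n → Bool
  isSingleton S = ∣ S ∣ ℕ.≡ᵇ 1

  ∣++∣ : ∀ {m n} (L : Subset m) (R : Subset n) → ∣ L ++ R ∣ ≡ ∣ L ∣ ℕ.+ ∣ R ∣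
  ∣++∣ []          R = refl
  ∣++∣ (true ∷ L)  R = cong suc (∣++∣ L R)
  ∣++∣ (false ∷ L) R = ∣++∣ L R

  nonemptyB≡not-isEmpty : ∀ {n} (S : Subset n) → nonemptyB S ≡ not (isEmpty S)
  nonemptyB≡not-isEmpty []          = refl
  nonemptyB≡not-isEmpty (true ∷ S)  = refl
  nonemptyB≡not-isEmpty (false ∷ S) = nonemptyB≡not-isEmpty S

  ∣S∣≡0⇒∉ : ∀ {n} (S : Subset n) i → ∣ S ∣ ≡ 0 → lookup S i ≡ false
  ∣S∣≡0⇒∉ (false ∷ S) zero    _     = refl
  ∣S∣≡0⇒∉ (false ∷ S) (suc i) ∣S∣≡0 = ∣S∣≡0⇒∉ S i ∣S∣≡0

  ∈⇒∣S∣≢0 : ∀ {n} (S : Subset n) i → lookup S i ≡ true → ¬ ∣ S ∣ ≡ 0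
  ∈⇒∣S∣≢0 S i i∈S ∣S∣≡0 with () ← trans (sym i∈S) (∣S∣≡0⇒∉ S i ∣S∣≡0)

  ∣S∣≢0⇒∈ : ∀ {n} (S : Subset n) → ¬ ∣ S ∣ ≡ 0 → Σ (Fin n) λ i → lookup S i ≡ true
  ∣S∣≢0⇒∈ []          ∣S∣≢0 = contradiction refl ∣S∣≢0
  ∣S∣≢0⇒∈ (true ∷ S)  _     = zero , refl
  ∣S∣≢0⇒∈ (false ∷ S) ∣S∣≢0 with ∣S∣≢0⇒∈ S ∣S∣≢0
  ... | i , i∈S = suc i , i∈S

  ∣S∣≡1⇒unique : ∀ {n} (S : Subset n) u v → ∣ S ∣ ≡ 1 → lookup S u ≡ true → lookup S v ≡ true → u ≡ v
  ∣S∣≡1⇒unique (true ∷ S)  zero    zero    _  _   _   = refl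
  ∣S∣≡1⇒unique (true ∷ S)  zero    (suc v) ∣S∣≡1 _ v∈S = contradiction (ℕ.suc-injective ∣S∣≡1) (∈⇒∣S∣≢0 S v v∈S)
  ∣S∣≡1⇒unique (true ∷ S)  (suc u) _       ∣S∣≡1 u∈S _ = contradiction (ℕ.suc-injective ∣S∣≡1) (∈⇒∣S∣≢0 S u u∈S)
  ∣S∣≡1⇒unique (false ∷ S) (suc u) (suc v) ∣S∣≡1 u∈S v∈S = cong suc (∣S∣≡1⇒unique S u v ∣S∣≡1 u∈S v∈S)

  ∣S∣≢1⇒another : ∀ {n} (S : Subset n) u → lookup S u ≡ true → ¬ ∣ S ∣ ≡ 1 → Σ (Fin n) λ v → lookup S v ≡ true × ¬ v ≡ u
  ∣S∣≢1⇒another (true ∷ S) zero _ ∣S∣≢1 with ∣S∣≢0⇒∈ S (λ ∣S∣≡0 → ∣S∣≢1 (cong suc ∣S∣≡0))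
  ... | v , v∈S = suc v , v∈S , λ ()
  ∣S∣≢1⇒another (true ∷ S)  (suc u) _   _     = zero , refl , λ ()
  ∣S∣≢1⇒another (false ∷ S) (suc u) u∈S ∣S∣≢1 with ∣S∣≢1⇒another S u u∈S ∣S∣≢1
  ... | v , v∈S , v≢u = suc v , v∈S , λ sv≡su → v≢u (suc-injective sv≡su)

  isEmpty⇒∣∣≡0 : ∀ {n} (S : Subset n) → isEmpty S ≡ true → ∣ S ∣ ≡ 0
  isEmpty⇒∣∣≡0 S e with ∣ S ∣
  ... | zero = refl

  isSingleton⇒∣∣≡1 : ∀ {n} (S : Subset n) → isSingleton S ≡ true → ∣ S ∣ ≡ 1
  isSingleton⇒∣∣≡1 S e with ∣ S ∣
  ... | 1 = refl

  ¬isSingleton⇒∣∣≢1 : ∀ {n} (S : Subset n) → isSingleton S ≡ false → ¬ ∣ S ∣ ≡ 1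
  ¬isSingleton⇒∣∣≢1 S e ∣S∣≡1 with () ← trans (sym e) (cong (ℕ._≡ᵇ 1) ∣S∣≡1)

module SubsetSums where

  open import Defs using (_^_; sumℚ; allSubsets)
  open RationalArithmetic using (fromℕ)
  open Subsets using (isEmpty; isSingleton)
  open import Data.Bool using (Bool; true; false; _∧_; if_then_else_)
  open import Data.Nat as ℕ using (ℕ; zero; suc)
  import Data.Nat.Properties as ℕ
  open import Data.List using (List; []; _∷_; map; _++_)
  open import Data.List.Properties using (map-++; map-cong; map-∘)
  open import Data.Vec using (_∷_; [])
  import Data.Vec as Vec
  open import Data.Fin.Subset using (Subset; ∣_∣)
  open import Data.Fin.Subset.Properties using (∣p∣≤n)
  open import Data.Rational using (ℚ; 0ℚ; 1ℚ; _+_; _*_; _-_; -_)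
  open import Data.Rational.Properties
  open import Data.Rational.Solver using (module +-*-Solver)
  open import Relation.Binary.PropositionalEquality

  open +-*-Solver

  sumℚ-++ : ∀ (xs ys : List ℚ) → sumℚ (xs ++ ys) ≡ sumℚ xs + sumℚ ys
  sumℚ-++ []       ys = sym (+-identityˡ _)
  sumℚ-++ (x ∷ xs) ys = trans (cong (x +_) (sumℚ-++ xs ys)) (sym (+-assoc x (sumℚ xs) (sumℚ ys)))

  module _ {A : Set} where

    sum-map-+ : ∀ (f g : A → ℚ) xs → sumℚ (map (λ x → f x + g x) xs) ≡ sumℚ (map f xs) + sumℚ (map g xs)
    sum-map-+ f g []       = sym (+-identityˡ 0ℚ)
    sum-map-+ f g (x ∷ xs) = trans (cong (f x + g x +_) (sum-map-+ f g xs))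
      (solve 4 (λ a b c d → (a :+ b) :+ (c :+ d) := (a :+ c) :+ (b :+ d)) refl (f x) (g x) (sumℚ (map f xs)) (sumℚ (map g xs)))

    sum-map-neg : ∀ (f : A → ℚ) xs → sumℚ (map (λ x → - f x) xs) ≡ - sumℚ (map f xs)
    sum-map-neg f []       = refl
    sum-map-neg f (x ∷ xs) = trans (cong (- f x +_) (sum-map-neg f xs)) (sym (neg-distrib-+ (f x) (sumℚ (map f xs))))

    sum-map-*ˡ : ∀ c (f : A → ℚ) xs → sumℚ (map (λ x → c * f x) xs) ≡ c * sumℚ (map f xs)
    sum-map-*ˡ c f []       = sym (*-zeroʳ c)
    sum-map-*ˡ c f (x ∷ xs) = trans (cong (c * f x +_) (sum-map-*ˡ c f xs)) (sym (*-distribˡ-+ c (f x) (sumℚ (map f xs))))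

    sum-map-*ʳ : ∀ c (f : A → ℚ) xs → sumℚ (map (λ x → f x * c) xs) ≡ sumℚ (map f xs) * c
    sum-map-*ʳ c f []       = sym (*-zeroˡ c)
    sum-map-*ʳ c f (x ∷ xs) = trans (cong (f x * c +_) (sum-map-*ʳ c f xs)) (sym (*-distribʳ-+ c (f x) (sumℚ (map f xs))))

    sum-map-0 : ∀ (xs : List A) → sumℚ (map (λ _ → 0ℚ) xs) ≡ 0ℚ
    sum-map-0 []       = refl
    sum-map-0 (x ∷ xs) = trans (cong (0ℚ +_) (sum-map-0 xs)) (+-identityˡ 0ℚ)

  sumSubsets : ∀ n → (Subset n → ℚ) → ℚ
  sumSubsets n g = sumℚ (map g (allSubsets n))

  module _ (n : ℕ) where

    sumSubsets-cong : ∀ {f g : Subset n → ℚ} → (∀ S → f S ≡ g S) → sumSubsets n f ≡ sumSubsets n g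
    sumSubsets-cong f≗g = cong sumℚ (map-cong f≗g (allSubsets n))

    sumSubsets-+ : ∀ (f g : Subset n → ℚ) → sumSubsets n (λ S → f S + g S) ≡ sumSubsets n f + sumSubsets n g
    sumSubsets-+ f g = sum-map-+ f g (allSubsets n)

    sumSubsets-- : ∀ (f g : Subset n → ℚ) → sumSubsets n (λ S → f S - g S) ≡ sumSubsets n f - sumSubsets n g
    sumSubsets-- f g = trans (sumSubsets-+ f (λ S → - g S)) (cong (sumSubsets n f +_) (sum-map-neg g (allSubsets n)))

    sumSubsets-*ˡ : ∀ c (f : Subset n → ℚ) → sumSubsets n (λ S → c * f S) ≡ c * sumSubsets n f
    sumSubsets-*ˡ c f = sum-map-*ˡ c f (allSubsets n)

    sumSubsets-*ʳ : ∀ c (f : Subset n → ℚ) → sumSubsets n (λ S → f S * c) ≡ sumSubsets n f * c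
    sumSubsets-*ʳ c f = sum-map-*ʳ c f (allSubsets n)

    sumSubsets-0 : sumSubsets n (λ _ → 0ℚ) ≡ 0ℚ
    sumSubsets-0 = sum-map-0 (allSubsets n)

  sumSubsets-suc : ∀ n g → sumSubsets (suc n) g ≡ sumSubsets n (λ S → g (true ∷ S)) + sumSubsets n (λ S → g (false ∷ S))
  sumSubsets-suc n g = begin
    sumℚ (map g (map (true ∷_) Ss ++ map (false ∷_) Ss))                 ≡⟨ cong sumℚ (map-++ g (map (true ∷_) Ss) (map (false ∷_) Ss)) ⟩
    sumℚ (map g (map (true ∷_) Ss) ++ map g (map (false ∷_) Ss))         ≡⟨ sumℚ-++ (map g (map (true ∷_) Ss)) (map g (map (false ∷_) Ss)) ⟩
    sumℚ (map g (map (true ∷_) Ss)) + sumℚ (map g (map (false ∷_) Ss))   ≡⟨ sym (cong₂ (λ xs ys → sumℚ xs + sumℚ ys) (map-∘ Ss) (map-∘ Ss)) ⟩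
    sumSubsets n (λ S → g (true ∷ S)) + sumSubsets n (λ S → g (false ∷ S)) ∎
    where
    open ≡-Reasoning
    Ss = allSubsets n

  sumSubsets-++ : ∀ m n (g : Subset (m ℕ.+ n) → ℚ) → sumSubsets (m ℕ.+ n) g ≡ sumSubsets m (λ L → sumSubsets n (λ R → g (L Vec.++ R)))
  sumSubsets-++ zero    n g = sym (+-identityʳ _)
  sumSubsets-++ (suc m) n g = begin
    sumSubsets (suc m ℕ.+ n) g
      ≡⟨ sumSubsets-suc (m ℕ.+ n) g ⟩
    sumSubsets (m ℕ.+ n) (λ S → g (true ∷ S)) + sumSubsets (m ℕ.+ n) (λ S → g (false ∷ S))
      ≡⟨ cong₂ _+_ (sumSubsets-++ m n (λ S → g (true ∷ S))) (sumSubsets-++ m n (λ S → g (false ∷ S))) ⟩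
    sumSubsets m (λ L → sumSubsets n (λ R → g (true ∷ L Vec.++ R))) + sumSubsets m (λ L → sumSubsets n (λ R → g (false ∷ L Vec.++ R)))
                                                                                            ≡⟨ sym (sumSubsets-suc m (λ L → sumSubsets n (λ R → g (L Vec.++ R)))) ⟩
    sumSubsets (suc m) (λ L → sumSubsets n (λ R → g (L Vec.++ R))) ∎
    where open ≡-Reasoning

  onlyIf : Bool → ℚ → ℚ
  onlyIf b x = if b then x else 0ℚ

  onlyIf-∧ : ∀ a b x y → onlyIf (a ∧ b) (x * y) ≡ onlyIf a x * onlyIf b y
  onlyIf-∧ true  true  x y = refl
  onlyIf-∧ true  false x y = sym (*-zeroʳ x)
  onlyIf-∧ false b     x y = sym (*-zeroˡ (onlyIf b y))

  onlyIf-*ˡ : ∀ b c x → onlyIf b (c * x) ≡ c * onlyIf b x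
  onlyIf-*ˡ true  c x = refl
  onlyIf-*ˡ false c x = sym (*-zeroʳ c)

  weight : ∀ {n} → ℚ → Subset n → ℚ
  weight p []      = 1ℚ
  weight p (b ∷ S) = (if b then p else 1ℚ - p) * weight p S

  ^∣S∣*^∣∁S∣≡weight : ∀ {n} p (S : Subset n) → p ^ ∣ S ∣ * (1ℚ - p) ^ (n ℕ.∸ ∣ S ∣) ≡ weight p S
  ^∣S∣*^∣∁S∣≡weight p []          = refl
  ^∣S∣*^∣∁S∣≡weight p (true ∷ S)  = trans (*-assoc p (p ^ ∣ S ∣) _) (cong (p *_) (^∣S∣*^∣∁S∣≡weight p S))
  ^∣S∣*^∣∁S∣≡weight {suc n} p (false ∷ S) rewrite ℕ.+-∸-assoc 1 (∣p∣≤n S) = begin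
    p ^ ∣ S ∣ * ((1ℚ - p) * (1ℚ - p) ^ (n ℕ.∸ ∣ S ∣))
      ≡⟨ solve 3 (λ P q Q → P :* (q :* Q) := q :* (P :* Q)) refl (p ^ ∣ S ∣) (1ℚ - p) ((1ℚ - p) ^ (n ℕ.∸ ∣ S ∣)) ⟩
    (1ℚ - p) * (p ^ ∣ S ∣ * (1ℚ - p) ^ (n ℕ.∸ ∣ S ∣))
      ≡⟨ cong ((1ℚ - p) *_) (^∣S∣*^∣∁S∣≡weight p S) ⟩
    (1ℚ - p) * weight p S ∎
    where open ≡-Reasoning

  weight-++ : ∀ {m n} p (L : Subset m) (R : Subset n) → weight p (L Vec.++ R) ≡ weight p L * weight p R
  weight-++ p []      R = sym (*-identityˡ _)
  weight-++ p (b ∷ L) R = trans (cong ((if b then p else 1ℚ - p) *_) (weight-++ p L R)) (sym (*-assoc (if b then p else 1ℚ - p) (weight p L) (weight p R)))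

  sumSubsets-onlyIf-* : ∀ m n (a : Subset m → Bool) (b : Subset n → Bool) (f : Subset m → ℚ) (g : Subset n → ℚ) →
    sumSubsets m (λ L → sumSubsets n (λ R → onlyIf (a L ∧ b R) (f L * g R)))
      ≡ sumSubsets m (λ L → onlyIf (a L) (f L)) * sumSubsets n (λ R → onlyIf (b R) (g R))
  sumSubsets-onlyIf-* m n a b f g = begin
    sumSubsets m (λ L → sumSubsets n (λ R → onlyIf (a L ∧ b R) (f L * g R)))
      ≡⟨ sumSubsets-cong m (λ L → sumSubsets-cong n (λ R → onlyIf-∧ (a L) (b R) (f L) (g R))) ⟩
    sumSubsets m (λ L → sumSubsets n (λ R → onlyIf (a L) (f L) * onlyIf (b R) (g R)))
      ≡⟨ sumSubsets-cong m (λ L → sumSubsets-*ˡ n (onlyIf (a L) (f L)) _) ⟩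
    sumSubsets m (λ L → onlyIf (a L) (f L) * sumSubsets n (λ R → onlyIf (b R) (g R)))
      ≡⟨ sumSubsets-*ʳ m _ _ ⟩
    sumSubsets m (λ L → onlyIf (a L) (f L)) * sumSubsets n (λ R → onlyIf (b R) (g R)) ∎
    where open ≡-Reasoning

  weight-block : ∀ {m n} p c (L : Subset m) (R : Subset n) → weight p (c ∷ L Vec.++ R) ≡ ((if c then p else 1ℚ - p) * weight p L) * weight p R
  weight-block p c L R = trans (cong ((if c then p else 1ℚ - p) *_) (weight-++ p L R))
                               (sym (*-assoc (if c then p else 1ℚ - p) (weight p L) (weight p R)))

  module _ (p : ℚ) where
    private
      q = 1ℚ - p

    Σweight : ∀ n → sumSubsets n (weight p) ≡ 1ℚ
    Σweight zero    = refl
    Σweight (suc n) = begin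
      sumSubsets (suc n) (weight p)
        ≡⟨ sumSubsets-suc n (weight p) ⟩
      sumSubsets n (λ S → p * weight p S) + sumSubsets n (λ S → q * weight p S)
        ≡⟨ cong₂ _+_ (sumSubsets-*ˡ n p (weight p)) (sumSubsets-*ˡ n q (weight p)) ⟩
      p * sumSubsets n (weight p) + q * sumSubsets n (weight p)
        ≡⟨ cong (λ s → p * s + q * s) (Σweight n) ⟩
      p * 1ℚ + q * 1ℚ
        ≡⟨ solve 1 (λ p → p :* con 1ℚ :+ (con 1ℚ :- p) :* con 1ℚ := con 1ℚ) refl p ⟩
      1ℚ ∎
      where open ≡-Reasoning

    Σweight-onlyIf-*ˡ : ∀ n (P : Subset n → Bool) c → sumSubsets n (λ S → onlyIf (P S) (c * weight p S)) ≡ c * sumSubsets n (λ S → onlyIf (P S) (weight p S))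
    Σweight-onlyIf-*ˡ n P c = trans (sumSubsets-cong n (λ S → onlyIf-*ˡ (P S) c (weight p S))) (sumSubsets-*ˡ n c _)

    Σweight-empty : ∀ n → sumSubsets n (λ S → onlyIf (isEmpty S) (weight p S)) ≡ q ^ n
    Σweight-empty zero    = refl
    Σweight-empty (suc n) = begin
      sumSubsets (suc n) (λ S → onlyIf (isEmpty S) (weight p S))
        ≡⟨ sumSubsets-suc n _ ⟩
      sumSubsets n (λ _ → 0ℚ) + sumSubsets n (λ S → onlyIf (isEmpty S) (q * weight p S))
        ≡⟨ cong₂ _+_ (sumSubsets-0 n) (Σweight-onlyIf-*ˡ n isEmpty q) ⟩
      0ℚ + q * sumSubsets n (λ S → onlyIf (isEmpty S) (weight p S))
        ≡⟨ cong (λ s → 0ℚ + q * s) (Σweight-empty n) ⟩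
      0ℚ + q * q ^ n
        ≡⟨ +-identityˡ _ ⟩
      q ^ suc n ∎
      where open ≡-Reasoning

    Σweight-singleton : ∀ n → sumSubsets (suc n) (λ S → onlyIf (isSingleton S) (weight p S)) ≡ fromℕ (suc n) * p * q ^ n
    Σweight-singleton zero = begin
      p * 1ℚ + (0ℚ + 0ℚ)      ≡⟨ solve 1 (λ p → p :* con 1ℚ :+ (con 0ℚ :+ con 0ℚ) := (con 1ℚ :+ con 0ℚ) :* p :* con 1ℚ) refl p ⟩
      fromℕ 1 * p * q ^ 0     ∎
      where open ≡-Reasoning
    Σweight-singleton (suc n) = begin
      sumSubsets (suc (suc n)) (λ S → onlyIf (isSingleton S) (weight p S))
        ≡⟨ sumSubsets-suc (suc n) _ ⟩
      sumSubsets (suc n) (λ S → onlyIf (isEmpty S) (p * weight p S)) + sumSubsets (suc n) (λ S → onlyIf (isSingleton S) (q * weight p S))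
        ≡⟨ cong₂ _+_ (Σweight-onlyIf-*ˡ (suc n) isEmpty p) (Σweight-onlyIf-*ˡ (suc n) isSingleton q) ⟩
      p * sumSubsets (suc n) (λ S → onlyIf (isEmpty S) (weight p S)) + q * sumSubsets (suc n) (λ S → onlyIf (isSingleton S) (weight p S))
        ≡⟨ cong₂ (λ s t → p * s + q * t) (Σweight-empty (suc n)) (Σweight-singleton n) ⟩
      p * q ^ suc n + q * (fromℕ (suc n) * p * q ^ n)
        ≡⟨ solve 3 (λ p Q m → p :* ((con 1ℚ :- p) :* Q) :+ (con 1ℚ :- p) :* ((con 1ℚ :+ m) :* p :* Q) := (con 1ℚ :+ (con 1ℚ :+ m)) :* p :* ((con 1ℚ :- p) :* Q)) refl p (q ^ n) (fromℕ n) ⟩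
      fromℕ (suc (suc n)) * p * q ^ suc n ∎
      where open ≡-Reasoning

module PendantClique where

  open import Defs hiding (sym)
  open Subsets
  open Reachability
  open import Data.Bool using (Bool; true; false; _∧_; _∨_; not; T)
  open import Data.Bool.Properties using (∨-comm)
  open import Data.Nat as ℕ using (ℕ; zero; suc)
  import Data.Nat.Properties as ℕ
  open import Data.Fin as Fin using (Fin; zero; suc; splitAt; _↑ˡ_; _↑ʳ_)
  open import Data.Fin.Properties using (splitAt-↑ˡ; splitAt-↑ʳ; splitAt⁻¹-↑ˡ; splitAt⁻¹-↑ʳ)
  open import Data.Fin.Subset using (Subset; ∣_∣)
  open import Data.Fin.Subset.Properties using (∣⊤∣≡n)
  open import Data.List using (List; []; _∷_; allFin; applyUpTo)
  import Data.List as List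
  open import Data.Vec using (Vec; []; _∷_; _++_; take; drop)
  import Data.Vec as Vec
  open import Data.Vec.Properties using (lookup-++ˡ; lookup-++ʳ; take++drop≡id; ++-injective)
  open import Data.Sum using (_⊎_; inj₁; inj₂)
  open import Data.Product using (Σ; _×_; _,_)
  open import Relation.Nullary using (¬_; Dec; yes; no; does; contradiction)
  open import Relation.Nullary.Decidable using (dec-true; dec-false)
  open import Relation.Binary.PropositionalEquality

  -- The vertices of pendantClique ms come in blocks, one for each m in ms: a centre followed by
  -- m leaves.  The centres form a clique and each leaf is adjacent only to its centre.
  size : List ℕ → ℕ
  size []       = 0
  size (m ∷ ms) = suc m ℕ.+ size ms

  applyUpTo-++ : ∀ {A : Set} (f : ℕ → A) m n → applyUpTo f (m ℕ.+ n) ≡ applyUpTo f m List.++ applyUpTo (λ j → f (m ℕ.+ j)) n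
  applyUpTo-++ f zero    n = refl
  applyUpTo-++ f (suc m) n = cong (f 0 ∷_) (applyUpTo-++ (λ j → f (suc j)) m n)

  size-applyUpTo : ∀ f n {b} → (∀ {j} → j ℕ.< n → suc (f j) ℕ.≤ b) → size (applyUpTo f n) ℕ.≤ n ℕ.* b
  size-applyUpTo f zero    _      = ℕ.z≤n
  size-applyUpTo f (suc n) bounded = ℕ.+-mono-≤ (bounded (ℕ.s≤s ℕ.z≤n)) (size-applyUpTo (λ j → f (suc j)) n (λ j<n → bounded (ℕ.s≤s j<n)))

  _==_ : ∀ {n} → Fin n → Fin n → Bool
  u == v = does (u Fin.≟ v)

  ==-refl : ∀ {n} (u : Fin n) → (u == u) ≡ true
  ==-refl u = dec-true (u Fin.≟ u) refl

  ==-≢ : ∀ {n} {u v : Fin n} → ¬ u ≡ v → (u == v) ≡ false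
  ==-≢ {u = u} {v} = dec-false (u Fin.≟ v)

  ==-sym : ∀ {n} (u v : Fin n) → (u == v) ≡ (v == u)
  ==-sym u v with u Fin.≟ v
  ... | yes refl = sym (==-refl u)
  ... | no u≢v  = sym (==-≢ (λ v≡u → u≢v (sym v≡u)))

  ==⇒≡ : ∀ {n} {u v : Fin n} → (u == v) ≡ true → u ≡ v
  ==⇒≡ {u = u} {v} u==v with u Fin.≟ v
  ... | yes u≡v = u≡v

  isCentre : ∀ ms → Fin (size ms) → Bool
  isCentre (m ∷ ms) v with splitAt (suc m) v
  ... | inj₁ zero    = true
  ... | inj₁ (suc _) = false
  ... | inj₂ j       = isCentre ms j

  centre : ∀ ms → Fin (size ms) → Fin (size ms)
  centre (m ∷ ms) v with splitAt (suc m) v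
  ... | inj₁ _ = zero
  ... | inj₂ j = suc m ↑ʳ centre ms j

  centre-isCentre : ∀ ms v → isCentre ms (centre ms v) ≡ true
  centre-isCentre (m ∷ ms) v with splitAt (suc m) v
  ... | inj₁ _ = refl
  ... | inj₂ j rewrite splitAt-↑ʳ (suc m) (size ms) (centre ms j) = centre-isCentre ms j

  centre-of-centre : ∀ ms v → isCentre ms v ≡ true → centre ms v ≡ v
  centre-of-centre (m ∷ ms) v c with splitAt (suc m) v in eq
  ... | inj₁ zero = splitAt⁻¹-↑ˡ eq
  ... | inj₂ j    = trans (cong (suc m ↑ʳ_) (centre-of-centre ms j c)) (splitAt⁻¹-↑ʳ eq)

  centre-of-leaf-≢ : ∀ ms v → isCentre ms v ≡ false → ¬ centre ms v ≡ v
  centre-of-leaf-≢ ms v leaf centre≡v with () ← trans (sym (centre-isCentre ms v)) (trans (cong (isCentre ms) centre≡v) leaf)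

  pendantAdj : ∀ ms → Fin (size ms) → Fin (size ms) → Bool
  pendantAdj ms u v = (isCentre ms u ∧ isCentre ms v ∧ not (u == v))
                    ∨ ((not (isCentre ms u) ∧ (centre ms u == v)) ∨ (not (isCentre ms v) ∧ (centre ms v == u)))

  pendantAdj-sym : ∀ ms u v → pendantAdj ms u v ≡ pendantAdj ms v u
  pendantAdj-sym ms u v
    rewrite ==-sym u v | ∨-comm (not (isCentre ms u) ∧ (centre ms u == v)) (not (isCentre ms v) ∧ (centre ms v == u))
    with isCentre ms u | isCentre ms v
  ... | true  | true  = refl
  ... | true  | false = refl
  ... | false | true  = refl
  ... | false | false = refl

  pendantAdj-irrefl : ∀ ms u → pendantAdj ms u u ≡ false
  pendantAdj-irrefl ms u rewrite ==-refl u with isCentre ms u in c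
  ... | true  = refl
  ... | false rewrite ==-≢ (centre-of-leaf-≢ ms u c) = refl

  pendantClique : List ℕ → Graph
  pendantClique ms = record { n = size ms ; adj = pendantAdj ms ; sym = pendantAdj-sym ms ; irrefl = pendantAdj-irrefl ms }

  adj-leaf-centre : ∀ ms u → isCentre ms u ≡ false → pendantAdj ms u (centre ms u) ≡ true
  adj-leaf-centre ms u leaf rewrite leaf | ==-refl (centre ms u) = refl

  adj-centres : ∀ ms u v → ¬ centre ms u ≡ centre ms v → pendantAdj ms (centre ms u) (centre ms v) ≡ true
  adj-centres ms u v ≢ rewrite centre-isCentre ms u | centre-isCentre ms v | ==-≢ ≢ = refl

  adj-leaf⇒centre : ∀ ms l w → isCentre ms l ≡ false → pendantAdj ms l w ≡ true → w ≡ centre ms l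
  adj-leaf⇒centre ms l w leaf lw rewrite leaf with centre ms l == w in eq | not (isCentre ms w) | centre ms w == l in eq′
  ... | true  | _     | _     = sym (==⇒≡ eq)
  ... | false | true  | true  = contradiction (trans (sym (centre-isCentre ms w)) (trans (cong (isCentre ms) (==⇒≡ eq′)) leaf)) λ ()

  data BlockView (m : ℕ) (ms : List ℕ) : Fin (size (m ∷ ms)) → Set where
    centre₀ : BlockView m ms zero
    leaf₀   : ∀ i → BlockView m ms (suc i ↑ˡ size ms)
    later   : ∀ j → BlockView m ms (suc m ↑ʳ j)

  blockView : ∀ m ms u → BlockView m ms u
  blockView m ms u with splitAt (suc m) u in eq
  ... | inj₁ zero    = subst (BlockView m ms) (splitAt⁻¹-↑ˡ eq) centre₀
  ... | inj₁ (suc i) = subst (BlockView m ms) (splitAt⁻¹-↑ˡ eq) (leaf₀ i)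
  ... | inj₂ j       = subst (BlockView m ms) (splitAt⁻¹-↑ʳ eq) (later j)

  module _ (m : ℕ) (ms : List ℕ) where

    isCentre-leaf₀ : ∀ i → isCentre (m ∷ ms) (suc i ↑ˡ size ms) ≡ false
    isCentre-leaf₀ i rewrite splitAt-↑ˡ (suc m) (suc i) (size ms) = refl

    centre-leaf₀ : ∀ i → centre (m ∷ ms) (suc i ↑ˡ size ms) ≡ zero
    centre-leaf₀ i rewrite splitAt-↑ˡ (suc m) (suc i) (size ms) = refl

    isCentre-later : ∀ j → isCentre (m ∷ ms) (suc m ↑ʳ j) ≡ isCentre ms j
    isCentre-later j rewrite splitAt-↑ʳ (suc m) (size ms) j = refl

    centre-later : ∀ j → centre (m ∷ ms) (suc m ↑ʳ j) ≡ suc m ↑ʳ centre ms j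
    centre-later j rewrite splitAt-↑ʳ (suc m) (size ms) j = refl

  take-drop-++ : ∀ {A : Set} {m n} (L : Vec A m) (R : Vec A n) → take m (L ++ R) ≡ L × drop m (L ++ R) ≡ R
  take-drop-++ {m = m} L R = ++-injective (take m (L ++ R)) L (take++drop≡id m (L ++ R))

  splitBlock : ∀ m {n} (S : Subset (suc m ℕ.+ n)) → Σ Bool λ c → Σ (Subset m) λ L → Σ (Subset n) λ R → S ≡ c ∷ (L ++ R)
  splitBlock m (c ∷ S) = c , take m S , drop m S , cong (c ∷_) (sym (take++drop≡id m S))

  -- every leaf in S has its centre in S
  closedB : ∀ ms → Subset (size ms) → Bool
  closedB []       []      = true
  closedB (m ∷ ms) (c ∷ S) = (c ∨ isEmpty (take m S)) ∧ closedB ms (drop m S)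

  closedB-∷-++ : ∀ m ms c (L : Subset m) (R : Subset (size ms)) → closedB (m ∷ ms) (c ∷ (L ++ R)) ≡ (c ∨ isEmpty L) ∧ closedB ms R
  closedB-∷-++ m ms c L R with take-drop-++ L R
  ... | takeL , dropR rewrite takeL | dropR = refl

  ∧-≡true : ∀ {a b} → a ∧ b ≡ true → a ≡ true × b ≡ true
  ∧-≡true {true} {true} _ = refl , refl

  ∨-≡true : ∀ {a b} → a ∨ b ≡ true → a ≡ true ⊎ b ≡ true
  ∨-≡true {true}  _ = inj₁ refl
  ∨-≡true {false} b = inj₂ b

  closed⇒centre∈ : ∀ ms S → closedB ms S ≡ true → ∀ u → mem u S ≡ true → isCentre ms u ≡ false → mem (centre ms u) S ≡ true
  closed⇒centre∈ (m ∷ ms) S closed u u∈S leaf with splitBlock m S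
  ... | c , L , R , refl with ∧-≡true {c ∨ isEmpty L} (trans (sym (closedB-∷-++ m ms c L R)) closed) | blockView m ms u
  ... | _ , _ | centre₀ with () ← leaf
  ... | c∨∅ , _ | leaf₀ i rewrite centre-leaf₀ m ms i with ∨-≡true c∨∅
  ...   | inj₁ c≡true = c≡true
  ...   | inj₂ L≡∅   = contradiction (isEmpty⇒∣∣≡0 L L≡∅) (∈⇒∣S∣≢0 L i (trans (sym (lookup-++ˡ L R i)) u∈S))
  closed⇒centre∈ (m ∷ ms) S closed u u∈S leaf | c , L , R , refl | _ , closedR | later j
    rewrite centre-later m ms j | lookup-++ʳ L R (centre ms j) =
    closed⇒centre∈ ms R closedR j (trans (sym (lookup-++ʳ L R j)) u∈S) (trans (sym (isCentre-later m ms j)) leaf)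

  LeafWithoutCentre : ∀ ms → Subset (size ms) → Set
  LeafWithoutCentre ms S = Σ (Fin (size ms)) λ u → mem u S ≡ true × isCentre ms u ≡ false × mem (centre ms u) S ≡ false

  ¬closed⇒leafWithoutCentre : ∀ ms S → closedB ms S ≡ false → LeafWithoutCentre ms S
  ¬closed⇒leafWithoutCentre []       []  ()
  ¬closed⇒leafWithoutCentre (m ∷ ms) S ¬closed with splitBlock m S
  ... | c , L , R , refl = block c (trans (sym (closedB-∷-++ m ms c L R)) ¬closed)
    where
    block : ∀ c → (c ∨ isEmpty L) ∧ closedB ms R ≡ false → LeafWithoutCentre (m ∷ ms) (c ∷ (L ++ R))
    block c _ with closedB ms R in closedR
    block c _ | false with ¬closed⇒leafWithoutCentre ms R closedR
    ... | j , j∈R , leaf , centre∉R =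
      suc m ↑ʳ j , trans (lookup-++ʳ L R j) j∈R , trans (isCentre-later m ms j) leaf ,
      trans (cong (λ z → mem z (c ∷ (L ++ R))) (centre-later m ms j)) (trans (lookup-++ʳ L R (centre ms j)) centre∉R)
    block false _ | true with isEmpty L in L≢∅
    block false _ | true | false with ∣S∣≢0⇒∈ L (λ ∣L∣≡0 → contradiction (trans (sym (cong (ℕ._≡ᵇ 0) ∣L∣≡0)) L≢∅) λ ())
    ... | i , i∈L = suc i ↑ˡ size ms , trans (lookup-++ˡ L R i) i∈L , isCentre-leaf₀ m ms i ,
                    cong (λ z → mem z (false ∷ (L ++ R))) (centre-leaf₀ m ms i)

  closed-∅ : ∀ ms S → ∣ S ∣ ≡ 0 → closedB ms S ≡ true
  closed-∅ []       []      _ = refl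
  closed-∅ (m ∷ ms) S ∣S∣≡0 with splitBlock m S
  closed-∅ (m ∷ ms) S ∣S∣≡0 | false , L , R , refl
    rewrite closedB-∷-++ m ms false L R | ∣++∣ L R with ∣ L ∣ | ∣ R ∣ in ∣R∣≡0
  ... | zero | zero = closed-∅ ms R ∣R∣≡0

  module _ (ms : List ℕ) (S : Subset (size ms)) where
    private
      G = pendantClique ms

    isCentre-case : ∀ u → isCentre ms u ≡ true ⊎ isCentre ms u ≡ false
    isCentre-case u with isCentre ms u
    ... | true  = inj₁ refl
    ... | false = inj₂ refl

    closed⇒reach₃ : closedB ms S ≡ true → ∀ u v → mem u S ≡ true → mem v S ≡ true → Reach G S 3 u v
    closed⇒reach₃ closed u v u∈S v∈S =
      reach-step G S 2 (toCentre u u∈S) (reach-step G S 1 betweenCentres (reach-step G S 0 fromCentre (reach-refl G S v)))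
      where
      centre∈ : ∀ w → mem w S ≡ true → mem (centre ms w) S ≡ true
      centre∈ w w∈S with isCentre-case w
      ... | inj₁ c    = subst (λ z → mem z S ≡ true) (sym (centre-of-centre ms w c)) w∈S
      ... | inj₂ leaf = closed⇒centre∈ ms S closed w w∈S leaf
      toCentre : ∀ w → mem w S ≡ true → Step G S w (centre ms w)
      toCentre w w∈S with isCentre-case w
      ... | inj₁ c    = inj₁ (sym (centre-of-centre ms w c))
      ... | inj₂ leaf = inj₂ (adj-leaf-centre ms w leaf , centre∈ w w∈S)
      betweenCentres : Step G S (centre ms u) (centre ms v)
      betweenCentres = step (centre ms u Fin.≟ centre ms v)
        where
        step : Dec (centre ms u ≡ centre ms v) → Step G S (centre ms u) (centre ms v)
        step (yes ≡) = inj₁ ≡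
        step (no ≢)  = inj₂ (adj-centres ms u v ≢ , centre∈ v v∈S)
      fromCentre : Step G S (centre ms v) v
      fromCentre with isCentre-case v
      ... | inj₁ c    = inj₁ (centre-of-centre ms v c)
      ... | inj₂ leaf = inj₂ (trans (pendantAdj-sym ms (centre ms v) v) (adj-leaf-centre ms v leaf) , v∈S)

    isolated : ∀ l v → isCentre ms l ≡ false → mem (centre ms l) S ≡ false → ¬ v ≡ l → ∀ k → reachW G S k l v ≡ false
    isolated l v leaf centre∉S v≢l zero    = reach₀-≢ G S (λ l≡v → v≢l (sym l≡v))
    isolated l v leaf centre∉S v≢l (suc k) rewrite isolated l v leaf centre∉S v≢l k =
      any-≡false (λ w → mem w S ∧ pendantAdj ms l w ∧ reachW G S k w v) (allFin (size ms)) noStep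
      where
      noStep : ∀ w → (mem w S ∧ pendantAdj ms l w ∧ reachW G S k w v) ≡ false
      noStep w with mem w S in w∈S | pendantAdj ms l w in lw
      ... | false | _     = refl
      ... | true  | false = refl
      ... | true  | true  with () ← trans (sym w∈S) (trans (cong (λ z → mem z S) (adj-leaf⇒centre ms l w leaf lw)) centre∉S)

  connectedB-pendantClique : ∀ ms → 3 ℕ.≤ size ms → (S : Subset (size ms)) →
    nonemptyB S ∧ inducedConnected (pendantClique ms) S ≡ not (isEmpty S) ∧ (closedB ms S ∨ isSingleton S)
  connectedB-pendantClique ms 3≤size S rewrite nonemptyB≡not-isEmpty S with isEmpty S
  ... | true  = refl
  ... | false with closedB ms S in closed
  ... | true  = connected-intro G S λ u v u∈S v∈S → reach-mono G S 3≤size (closed⇒reach₃ ms S closed u v u∈S v∈S)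
    where G = pendantClique ms
  ... | false with isSingleton S in single
  ... | true  = connected-intro G S λ u v u∈S v∈S →
                  subst (Reach G S (size ms) u) (∣S∣≡1⇒unique S u v (isSingleton⇒∣∣≡1 S single) u∈S v∈S)
                        (reach-mono G S {m′ = size ms} ℕ.z≤n (reach-refl G S u))
    where G = pendantClique ms
  ... | false with ¬closed⇒leafWithoutCentre ms S closed
  ... | l , l∈S , leaf , centre∉S with ∣S∣≢1⇒another S l l∈S (¬isSingleton⇒∣∣≢1 S single)
  ... | v , v∈S , v≢l = connected-elim (pendantClique ms) S l v l∈S v∈S (isolated ms S l v leaf centre∉S v≢l (size ms))

  drop-replicate : ∀ {A : Set} m {n} (x : A) → drop m (Vec.replicate (m ℕ.+ n) x) ≡ Vec.replicate n x
  drop-replicate zero    x = refl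
  drop-replicate (suc m) x = drop-replicate m x

  closed-full : ∀ ms → closedB ms (Vec.replicate (size ms) true) ≡ true
  closed-full []       = refl
  closed-full (m ∷ ms) = trans (cong (closedB ms) (drop-replicate m true)) (closed-full ms)

  ≡true⇒T : ∀ {b} → b ≡ true → T b
  ≡true⇒T refl = _

  pendantClique-connected : ∀ ms → 3 ℕ.≤ size ms → Connected (pendantClique ms)
  pendantClique-connected ms 3≤size with ∧-≡true (trans (connectedB-pendantClique ms 3≤size full) full-good)
    where
    full = Vec.replicate (size ms) true
    nonzero : ∀ {n} → 3 ℕ.≤ n → not (n ℕ.≡ᵇ 0) ≡ true
    nonzero (ℕ.s≤s _) = refl
    full-good : not (isEmpty full) ∧ (closedB ms full ∨ isSingleton full) ≡ true
    full-good rewrite closed-full ms | ∣⊤∣≡n (size ms) | nonzero 3≤size = refl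
  ... | nonempty , connected = ≡true⇒T nonempty , ≡true⇒T connected

module Reliability where

  open import Defs hiding (sym)
  open RationalArithmetic using (fromℕ; ^-distribˡ-+-*)
  open Subsets
  open SubsetSums
  open PendantClique
  open import Data.Bool using (true; false; _∧_)
  open import Data.Nat as ℕ using (ℕ; zero; suc)
  open import Data.List using (List; []; _∷_; map; length)
  open import Data.List.Properties using (map-cong)
  open import Data.Vec using (_∷_; _++_)
  open import Data.Fin.Subset using (Subset; ∣_∣)
  open import Data.Rational using (ℚ; 0ℚ; 1ℚ; _+_; _*_; _-_)
  open import Data.Rational.Properties
  open import Data.Rational.Solver using (module +-*-Solver)
  open import Relation.Nullary using (contradiction)
  open import Relation.Binary.PropositionalEquality

  open +-*-Solver

  -- the probability that a star with m leaves has its centre up or is entirely down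
  starFactor : ℕ → ℚ → ℚ
  starFactor m p = p + (1ℚ - p) ^ suc m

  starProduct : List ℕ → ℚ → ℚ
  starProduct []       p = 1ℚ
  starProduct (m ∷ ms) p = starFactor m p * starProduct ms p

  correction : ℚ → ℕ → ℚ → ℚ
  correction c N p = c * p * (1ℚ - p) ^ N - (1ℚ - p) ^ suc N

  -- names the summand that nodeRel introduces in a where clause
  summandOf : ∀ {G p} {t : Subset (n G) → ℚ} → nodeRel G p ≡ sumℚ (map t (allSubsets (n G))) → Subset (n G) → ℚ
  summandOf {t = t} _ = t

  nodeRel-summand : ∀ G p S → summandOf {G} {p} refl S ≡ onlyIf (nonemptyB S ∧ inducedConnected G S) (weight p S)
  nodeRel-summand G p S with nonemptyB S ∧ inducedConnected G S
  ... | true  = ^∣S∣*^∣∁S∣≡weight p S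
  ... | false = refl

  nodeRel≡sumSubsets : ∀ G p → nodeRel G p ≡ sumSubsets (n G) (λ S → onlyIf (nonemptyB S ∧ inducedConnected G S) (weight p S))
  nodeRel≡sumSubsets G p = cong sumℚ (map-cong (nodeRel-summand G p) (allSubsets (n G)))

  sumSubsets-blocks : ∀ m ms (g : Subset (size (m ∷ ms)) → ℚ) →
    sumSubsets (size (m ∷ ms)) g ≡ sumSubsets m (λ L → sumSubsets (size ms) (λ R → g (true ∷ L ++ R)))
                                 + sumSubsets m (λ L → sumSubsets (size ms) (λ R → g (false ∷ L ++ R)))
  sumSubsets-blocks m ms g = trans (sumSubsets-suc (m ℕ.+ size ms) g)
    (cong₂ _+_ (sumSubsets-++ m (size ms) (λ S → g (true ∷ S))) (sumSubsets-++ m (size ms) (λ S → g (false ∷ S))))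

  closed∧singleton-true : ∀ m ms (L : Subset m) (R : Subset (size ms)) →
    closedB (m ∷ ms) (true ∷ L ++ R) ∧ isSingleton (true ∷ L ++ R) ≡ isEmpty L ∧ isEmpty R
  closed∧singleton-true m ms L R rewrite closedB-∷-++ m ms true L R | ∣++∣ L R with ∣ L ∣ | ∣ R ∣ in ∣R∣ | closedB ms R in closedR
  ... | zero  | zero  | false = contradiction (trans (sym (closed-∅ ms R ∣R∣)) closedR) λ ()
  ... | zero  | zero  | true  = refl
  ... | zero  | suc _ | true  = refl
  ... | zero  | suc _ | false = refl
  ... | suc _ | _     | true  = refl
  ... | suc _ | _     | false = refl

  closed∧singleton-false : ∀ m ms (L : Subset m) (R : Subset (size ms)) →
    closedB (m ∷ ms) (false ∷ L ++ R) ∧ isSingleton (false ∷ L ++ R) ≡ isEmpty L ∧ (closedB ms R ∧ isSingleton R)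
  closed∧singleton-false m ms L R rewrite closedB-∷-++ m ms false L R | ∣++∣ L R with ∣ L ∣
  ... | zero  = refl
  ... | suc _ = refl

  module _ (p : ℚ) where
    private
      q = 1ℚ - p
      w : ∀ {n} → Subset n → ℚ
      w = weight p

    Σweight-closed∧singleton : ∀ ms → ℚ
    Σweight-closed∧singleton ms = sumSubsets (size ms) (λ S → onlyIf (closedB ms S ∧ isSingleton S) (w S))

    Σweight-block-empty : ∀ m c → sumSubsets m (λ L → onlyIf (isEmpty L) (c * w L)) ≡ c * q ^ m
    Σweight-block-empty m c = trans (Σweight-onlyIf-*ˡ p m isEmpty c) (cong (c *_) (Σweight-empty p m))

    Σweight-closed : ∀ ms → sumSubsets (size ms) (λ S → onlyIf (closedB ms S) (w S)) ≡ starProduct ms p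
    Σweight-closed []       = +-identityʳ 1ℚ
    Σweight-closed (m ∷ ms) = begin
      sumSubsets (size (m ∷ ms)) (λ S → onlyIf (closedB (m ∷ ms) S) (w S))
        ≡⟨ sumSubsets-blocks m ms _ ⟩
      sumSubsets m (λ L → sumSubsets (size ms) (λ R → onlyIf (closedB (m ∷ ms) (true ∷ L ++ R)) (w (true ∷ L ++ R))))
        + sumSubsets m (λ L → sumSubsets (size ms) (λ R → onlyIf (closedB (m ∷ ms) (false ∷ L ++ R)) (w (false ∷ L ++ R))))
        ≡⟨ cong₂ _+_ (sumSubsets-cong m λ L → sumSubsets-cong (size ms) λ R → cong₂ onlyIf (closedB-∷-++ m ms true L R) (weight-block p true L R))
                     (sumSubsets-cong m λ L → sumSubsets-cong (size ms) λ R → cong₂ onlyIf (closedB-∷-++ m ms false L R) (weight-block p false L R)) ⟩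
      sumSubsets m (λ L → sumSubsets (size ms) (λ R → onlyIf (true ∧ closedB ms R) ((p * w L) * w R)))
        + sumSubsets m (λ L → sumSubsets (size ms) (λ R → onlyIf (isEmpty L ∧ closedB ms R) ((q * w L) * w R)))
        ≡⟨ cong₂ _+_ (sumSubsets-onlyIf-* m (size ms) (λ _ → true) (closedB ms) (λ L → p * w L) w)
                     (sumSubsets-onlyIf-* m (size ms) isEmpty (closedB ms) (λ L → q * w L) w) ⟩
      sumSubsets m (λ L → p * w L) * Σ-ms + sumSubsets m (λ L → onlyIf (isEmpty L) (q * w L)) * Σ-ms
        ≡⟨ cong₂ (λ a b → a * Σ-ms + b * Σ-ms) (trans (sumSubsets-*ˡ m p w) (cong (p *_) (Σweight p m))) (Σweight-block-empty m q) ⟩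
      p * 1ℚ * Σ-ms + q * q ^ m * Σ-ms
        ≡⟨ cong (λ s → p * 1ℚ * s + q * q ^ m * s) (Σweight-closed ms) ⟩
      p * 1ℚ * starProduct ms p + q * q ^ m * starProduct ms p
        ≡⟨ solve 3 (λ p Q F → p :* con 1ℚ :* F :+ Q :* F := (p :+ Q) :* F) refl p (q * q ^ m) (starProduct ms p) ⟩
      starFactor m p * starProduct ms p ∎
      where
      open ≡-Reasoning
      Σ-ms = sumSubsets (size ms) (λ R → onlyIf (closedB ms R) (w R))

    Σweight-closed∧singleton-step : ∀ m ms → Σweight-closed∧singleton (m ∷ ms) ≡ p * q ^ m * q ^ size ms + q * q ^ m * Σweight-closed∧singleton ms
    Σweight-closed∧singleton-step m ms = begin
      Σweight-closed∧singleton (m ∷ ms)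
        ≡⟨ sumSubsets-blocks m ms _ ⟩
      sumSubsets m (λ L → sumSubsets (size ms) (λ R → onlyIf (closedB (m ∷ ms) (true ∷ L ++ R) ∧ isSingleton (true ∷ L ++ R)) (w (true ∷ L ++ R))))
        + sumSubsets m (λ L → sumSubsets (size ms) (λ R → onlyIf (closedB (m ∷ ms) (false ∷ L ++ R) ∧ isSingleton (false ∷ L ++ R)) (w (false ∷ L ++ R))))
        ≡⟨ cong₂ _+_ (sumSubsets-cong m λ L → sumSubsets-cong (size ms) λ R → cong₂ onlyIf (closed∧singleton-true m ms L R) (weight-block p true L R))
                     (sumSubsets-cong m λ L → sumSubsets-cong (size ms) λ R → cong₂ onlyIf (closed∧singleton-false m ms L R) (weight-block p false L R)) ⟩
      sumSubsets m (λ L → sumSubsets (size ms) (λ R → onlyIf (isEmpty L ∧ isEmpty R) ((p * w L) * w R)))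
        + sumSubsets m (λ L → sumSubsets (size ms) (λ R → onlyIf (isEmpty L ∧ (closedB ms R ∧ isSingleton R)) ((q * w L) * w R)))
        ≡⟨ cong₂ _+_ (sumSubsets-onlyIf-* m (size ms) isEmpty isEmpty (λ L → p * w L) w)
                     (sumSubsets-onlyIf-* m (size ms) isEmpty (λ R → closedB ms R ∧ isSingleton R) (λ L → q * w L) w) ⟩
      sumSubsets m (λ L → onlyIf (isEmpty L) (p * w L)) * sumSubsets (size ms) (λ R → onlyIf (isEmpty R) (w R))
        + sumSubsets m (λ L → onlyIf (isEmpty L) (q * w L)) * Σweight-closed∧singleton ms
        ≡⟨ cong₂ _+_ (cong₂ _*_ (Σweight-block-empty m p) (Σweight-empty p (size ms))) (cong (_* Σweight-closed∧singleton ms) (Σweight-block-empty m q)) ⟩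
      p * q ^ m * q ^ size ms + q * q ^ m * Σweight-closed∧singleton ms
        ∎
      where open ≡-Reasoning

    Σweight-closed∧singleton-∷ : ∀ m ms → Σweight-closed∧singleton (m ∷ ms) ≡ fromℕ (suc (length ms)) * p * q ^ (m ℕ.+ size ms)
    Σweight-closed∧singleton-∷ m [] = begin
      Σweight-closed∧singleton (m ∷ [])
        ≡⟨ Σweight-closed∧singleton-step m [] ⟩
      p * q ^ m * 1ℚ + q * q ^ m * (0ℚ + 0ℚ)
        ≡⟨ solve 3 (λ p q Q → p :* Q :* con 1ℚ :+ q :* Q :* (con 0ℚ :+ con 0ℚ) := (con 1ℚ :+ con 0ℚ) :* p :* Q) refl p q (q ^ m) ⟩
      fromℕ 1 * p * q ^ m
        ≡⟨ cong (λ k → fromℕ 1 * p * q ^ k) (sym (ℕ.+-identityʳ m)) ⟩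
      fromℕ 1 * p * q ^ (m ℕ.+ 0) ∎
      where
      open ≡-Reasoning
      import Data.Nat.Properties as ℕ
    Σweight-closed∧singleton-∷ m (m′ ∷ ms) = begin
      Σweight-closed∧singleton (m ∷ m′ ∷ ms)
        ≡⟨ Σweight-closed∧singleton-step m (m′ ∷ ms) ⟩
      p * q ^ m * (q * Q) + q * q ^ m * Σweight-closed∧singleton (m′ ∷ ms)
        ≡⟨ cong (λ s → p * q ^ m * (q * Q) + q * q ^ m * s) (Σweight-closed∧singleton-∷ m′ ms) ⟩
      p * q ^ m * (q * Q) + q * q ^ m * (k * p * Q)
        ≡⟨ solve 5 (λ p q A Q k → p :* A :* (q :* Q) :+ q :* A :* (k :* p :* Q) := (con 1ℚ :+ k) :* p :* (A :* (q :* Q))) refl p q (q ^ m) Q k ⟩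
      (1ℚ + k) * p * (q ^ m * q ^ size (m′ ∷ ms))
        ≡⟨ cong ((1ℚ + k) * p *_) (sym (^-distribˡ-+-* q m (size (m′ ∷ ms)))) ⟩
      (1ℚ + k) * p * q ^ (m ℕ.+ size (m′ ∷ ms)) ∎
      where
      open ≡-Reasoning
      k = fromℕ (suc (length ms))
      Q = q ^ (m′ ℕ.+ size ms)

  connected-inclusion-exclusion : ∀ ms → 3 ℕ.≤ size ms → ∀ p (S : Subset (size ms)) →
    onlyIf (nonemptyB S ∧ inducedConnected (pendantClique ms) S) (weight p S)
      ≡ onlyIf (closedB ms S) (weight p S) - onlyIf (isEmpty S) (weight p S)
        + onlyIf (isSingleton S) (weight p S) - onlyIf (closedB ms S ∧ isSingleton S) (weight p S)
  connected-inclusion-exclusion ms 3≤size p S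
    rewrite connectedB-pendantClique ms 3≤size S with ∣ S ∣ in ∣S∣ | closedB ms S in closed
  ... | zero          | false = contradiction (trans (sym (closed-∅ ms S ∣S∣)) closed) λ ()
  ... | zero          | true  = solve 1 (λ w → con 0ℚ := w :- w :+ con 0ℚ :- con 0ℚ) refl (weight p S)
  ... | suc zero      | true  = solve 1 (λ w → w := w :- con 0ℚ :+ w :- w) refl (weight p S)
  ... | suc zero      | false = solve 1 (λ w → w := con 0ℚ :- con 0ℚ :+ w :- con 0ℚ) refl (weight p S)
  ... | suc (suc _)   | true  = solve 1 (λ w → w := w :- con 0ℚ :+ con 0ℚ :- con 0ℚ) refl (weight p S)
  ... | suc (suc _)   | false = solve 0 (con 0ℚ := con 0ℚ :- con 0ℚ :+ con 0ℚ :- con 0ℚ) refl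

  nodeRel-pendantClique : ∀ m ms p → 3 ℕ.≤ size (m ∷ ms) →
    nodeRel (pendantClique (m ∷ ms)) p ≡ starProduct (m ∷ ms) p + correction (fromℕ (size (m ∷ ms)) - fromℕ (length (m ∷ ms))) (m ℕ.+ size ms) p
  nodeRel-pendantClique m ms p 3≤size = begin
    nodeRel (pendantClique (m ∷ ms)) p
      ≡⟨ nodeRel≡sumSubsets (pendantClique (m ∷ ms)) p ⟩
    sumSubsets (suc N) (λ S → onlyIf (nonemptyB S ∧ inducedConnected (pendantClique (m ∷ ms)) S) (w S))
      ≡⟨ sumSubsets-cong (suc N) (connected-inclusion-exclusion (m ∷ ms) 3≤size p) ⟩
    sumSubsets (suc N) (λ S → onlyIf (closedB (m ∷ ms) S) (w S) - onlyIf (isEmpty S) (w S) + onlyIf (isSingleton S) (w S) - onlyIf (closedB (m ∷ ms) S ∧ isSingleton S) (w S))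
      ≡⟨ trans (sumSubsets-- (suc N) _ _) (cong (_- Σweight-closed∧singleton p (m ∷ ms)) (trans (sumSubsets-+ (suc N) _ _) (cong (_+ sumSubsets (suc N) (λ S → onlyIf (isSingleton S) (w S))) (sumSubsets-- (suc N) _ _)))) ⟩
    Σweight-closed′ - sumSubsets (suc N) (λ S → onlyIf (isEmpty S) (w S)) + sumSubsets (suc N) (λ S → onlyIf (isSingleton S) (w S)) - Σweight-closed∧singleton p (m ∷ ms)
      ≡⟨ cong₂ _-_ (cong₂ _+_ (cong₂ _-_ (Σweight-closed p (m ∷ ms)) (Σweight-empty p (suc N))) (Σweight-singleton p N)) (Σweight-closed∧singleton-∷ p m ms) ⟩
    starProduct (m ∷ ms) p - q ^ suc N + fromℕ (suc N) * p * q ^ N - fromℕ (length (m ∷ ms)) * p * q ^ N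
      ≡⟨ solve 6 (λ F Q₁ a b p Q → F :- Q₁ :+ a :* p :* Q :- b :* p :* Q := F :+ ((a :- b) :* p :* Q :- Q₁))
               refl (starProduct (m ∷ ms) p) (q ^ suc N) (fromℕ (suc N)) (fromℕ (length (m ∷ ms))) p (q ^ N) ⟩
    starProduct (m ∷ ms) p + correction (fromℕ (suc N) - fromℕ (length (m ∷ ms))) N p ∎
    where
    open ≡-Reasoning
    N = m ℕ.+ size ms
    q = 1ℚ - p
    w : ∀ {n} → Subset n → ℚ
    w = weight p
    Σweight-closed′ = sumSubsets (suc N) (λ S → onlyIf (closedB (m ∷ ms) S) (w S))

module StarProduct where

  open import Defs using (_^_)
  open RationalArithmetic
  open PendantClique using (size)
  open Reliability using (starFactor; starProduct)
  open import Data.Nat as ℕ using (ℕ; zero; suc)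
  import Data.Nat.Properties as ℕ
  open import Data.List using (List; []; _∷_; _++_; length)
  open import Data.List.Relation.Unary.All using (All; []; _∷_)
  open import Data.Rational using (ℚ; 0ℚ; 1ℚ; _+_; _*_; _-_; -_; _<_; _≤_)
  open import Data.Rational.Properties
  open import Data.Rational.Solver using (module +-*-Solver)
  open import Relation.Binary.PropositionalEquality

  open +-*-Solver
  open ≤-Reasoning

  starProduct-++ : ∀ xs ys p → starProduct (xs ++ ys) p ≡ starProduct xs p * starProduct ys p
  starProduct-++ []       ys p = sym (*-identityˡ _)
  starProduct-++ (m ∷ xs) ys p = trans (cong (starFactor m p *_) (starProduct-++ xs ys p)) (sym (*-assoc (starFactor m p) _ _))

  module _ {p : ℚ} (0≤p : 0ℚ ≤ p) (p≤1 : p ≤ 1ℚ) where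
    private
      0≤1-p = p≤q⇒0≤q-p p≤1

    starFactor-nonNeg : ∀ m → 0ℚ ≤ starFactor m p
    starFactor-nonNeg m = +-nonNeg 0≤p (^-nonNeg (suc m) 0≤1-p)

    p≤starFactor : ∀ m → p ≤ starFactor m p
    p≤starFactor m = subst (_≤ starFactor m p) (+-identityʳ p) (+-monoʳ-≤ p (^-nonNeg (suc m) 0≤1-p))

    [1-p]^≤starFactor : ∀ m → (1ℚ - p) ^ suc m ≤ starFactor m p
    [1-p]^≤starFactor m = subst (_≤ starFactor m p) (+-identityˡ _) (+-monoˡ-≤ ((1ℚ - p) ^ suc m) 0≤p)

    starFactor≤1 : ∀ m → starFactor m p ≤ 1ℚ
    starFactor≤1 m = begin
      p + (1ℚ - p) ^ suc m   ≤⟨ +-monoʳ-≤ p (^-antimonoʳ-≤ {m = 1} {n = suc m} 0≤1-p (0≤p⇒1-p≤1 0≤p) (ℕ.s≤s ℕ.z≤n)) ⟩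
      p + (1ℚ - p) * 1ℚ      ≡⟨ solve 1 (λ p → p :+ (con 1ℚ :- p) :* con 1ℚ := con 1ℚ) refl p ⟩
      1ℚ                     ∎

    starProduct-nonNeg : ∀ ms → 0ℚ ≤ starProduct ms p
    starProduct-nonNeg []       = 0≤1
    starProduct-nonNeg (m ∷ ms) = *-nonNeg (starFactor-nonNeg m) (starProduct-nonNeg ms)

    starProduct≤1 : ∀ ms → starProduct ms p ≤ 1ℚ
    starProduct≤1 []       = ≤-refl
    starProduct≤1 (m ∷ ms) = *-mono-≤ (starFactor-nonNeg m) (starProduct-nonNeg ms) (starFactor≤1 m) (starProduct≤1 ms)

    p^length≤starProduct : ∀ ms → p ^ length ms ≤ starProduct ms p
    p^length≤starProduct []       = ≤-refl
    p^length≤starProduct (m ∷ ms) = *-mono-≤ 0≤p (^-nonNeg (length ms) 0≤p) (p≤starFactor m) (p^length≤starProduct ms)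

    [1-p]^size≤starProduct : ∀ ms → (1ℚ - p) ^ size ms ≤ starProduct ms p
    [1-p]^size≤starProduct []       = ≤-refl
    [1-p]^size≤starProduct (m ∷ ms) = subst (_≤ starProduct (m ∷ ms) p) (sym (^-distribˡ-+-* (1ℚ - p) (suc m) (size ms)))
      (*-mono-≤ (^-nonNeg (suc m) 0≤1-p) (^-nonNeg (size ms) 0≤1-p) ([1-p]^≤starFactor m) ([1-p]^size≤starProduct ms))

    starProduct≤V^length : ∀ {V} ms → All (λ m → starFactor m p ≤ V) ms → starProduct ms p ≤ V ^ length ms
    starProduct≤V^length []       []       = ≤-refl
    starProduct≤V^length (m ∷ ms) (h ∷ hs) = *-mono-≤ (starFactor-nonNeg m) (starProduct-nonNeg ms) h (starProduct≤V^length ms hs)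

  -- l V^(l-1), the derivative of V^l
  powSlope : ℕ → ℚ → ℚ
  powSlope zero    V = 0ℚ
  powSlope (suc l) V = V ^ l + V * powSlope l V

  powSlope-nonNeg : ∀ l {V} → 0ℚ ≤ V → 0ℚ ≤ powSlope l V
  powSlope-nonNeg zero    _   = ≤-refl
  powSlope-nonNeg (suc l) 0≤V = +-nonNeg (^-nonNeg l 0≤V) (*-nonNeg 0≤V (powSlope-nonNeg l 0≤V))

  powSlope-suc : ∀ l V → powSlope (suc l) V ≡ fromℕ (suc l) * V ^ l
  powSlope-suc zero    V = solve 1 (λ V → con 1ℚ :+ V :* con 0ℚ := (con 1ℚ :+ con 0ℚ) :* con 1ℚ) refl V
  powSlope-suc (suc l) V = begin-equality
    V * V ^ l + V * powSlope (suc l) V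
      ≡⟨ cong (λ s → V * V ^ l + V * s) (powSlope-suc l V) ⟩
    V * V ^ l + V * (fromℕ (suc l) * V ^ l)
      ≡⟨ solve 3 (λ V P m → V :* P :+ V :* ((con 1ℚ :+ m) :* P) := (con 1ℚ :+ (con 1ℚ :+ m)) :* (V :* P)) refl V (V ^ l) (fromℕ l) ⟩
    fromℕ (suc (suc l)) * V ^ suc l ∎

  powSlope-1 : ∀ l → powSlope l 1ℚ ≡ fromℕ l
  powSlope-1 zero    = refl
  powSlope-1 (suc l) = trans (powSlope-suc l 1ℚ) (trans (cong (fromℕ (suc l) *_) (1^n≡1 l)) (*-identityʳ _))

  module _ {x y : ℚ} (0≤x : 0ℚ ≤ x) (x≤y : x ≤ y) (y≤1 : y ≤ 1ℚ) where
    private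
      0≤y   = ≤-trans 0≤x x≤y
      0≤1-y = p≤q⇒0≤q-p y≤1
      1-y≤1-x : 1ℚ - y ≤ 1ℚ - x
      1-y≤1-x = -‿antimonoʳ-≤ 1ℚ x≤y

    starFactor-increment : ∀ m → starFactor m y - starFactor m x ≤ y - x
    starFactor-increment m = begin
      (y + (1ℚ - y) ^ suc m) - (x + (1ℚ - x) ^ suc m)   ≤⟨ +-monoˡ-≤ (- (x + (1ℚ - x) ^ suc m)) (+-monoʳ-≤ y (^-monoˡ-≤ (suc m) 0≤1-y 1-y≤1-x)) ⟩
      (y + (1ℚ - x) ^ suc m) - (x + (1ℚ - x) ^ suc m)   ≡⟨ solve 3 (λ x y Q → (y :+ Q) :- (x :+ Q) := y :- x) refl x y ((1ℚ - x) ^ suc m) ⟩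
      y - x                                             ∎

    -- the mean value bound, with the derivative 1 - (m+1)(1-p)^m evaluated at the right end
    starFactor-increment-sharp : ∀ m → starFactor m y - starFactor m x ≤ (y - x) * (1ℚ - fromℕ (suc m) * (1ℚ - y) ^ m)
    starFactor-increment-sharp m = begin
      (y + (1ℚ - y) ^ suc m) - (x + (1ℚ - x) ^ suc m)
        ≡⟨ solve 4 (λ x y A B → (y :+ A) :- (x :+ B) := (y :- x) :- (B :- A)) refl x y ((1ℚ - y) ^ suc m) ((1ℚ - x) ^ suc m) ⟩
      (y - x) - ((1ℚ - x) ^ suc m - (1ℚ - y) ^ suc m)
        ≤⟨ +-monoʳ-≤ (y - x) (neg-antimono-≤ (^-increment-lower 0≤1-y 1-y≤1-x m)) ⟩
      (y - x) - fromℕ (suc m) * (1ℚ - y) ^ m * ((1ℚ - x) - (1ℚ - y))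
        ≡⟨ solve 4 (λ x y a w → (y :- x) :- a :* w :* ((con 1ℚ :- x) :- (con 1ℚ :- y)) := (y :- x) :* (con 1ℚ :- a :* w)) refl x y (fromℕ (suc m)) ((1ℚ - y) ^ m) ⟩
      (y - x) * (1ℚ - fromℕ (suc m) * (1ℚ - y) ^ m) ∎

    starFactor≤p+[1-p]^m : ∀ m → starFactor m y ≤ y + (1ℚ - y) ^ m
    starFactor≤p+[1-p]^m m = +-monoʳ-≤ y (^-antimonoʳ-≤ 0≤1-y (0≤p⇒1-p≤1 0≤y) (ℕ.n≤1+n m))

    starProduct-increment : ∀ {V} ms → 0ℚ ≤ V → All (λ m → starFactor m y ≤ V) ms → All (λ m → starFactor m x ≤ V) ms →
                            starProduct ms y - starProduct ms x ≤ powSlope (length ms) V * (y - x)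
    starProduct-increment []       _   []       []       = ≤-reflexive (trans (+-inverseʳ 1ℚ) (sym (*-zeroˡ (y - x))))
    starProduct-increment {V} (m ∷ ms) 0≤V (fy≤V ∷ fys≤V) (fx≤V ∷ fxs≤V) = begin
      a * c - b * e
        ≡⟨ solve 4 (λ a b c e → a :* c :- b :* e := a :* (c :- e) :+ (a :- b) :* e) refl a b c e ⟩
      a * (c - e) + (a - b) * e
        ≤⟨ +-monoˡ-≤ ((a - b) * e) (*-monoˡ-≤ (starFactor-nonNeg 0≤y y≤1 m) (starProduct-increment ms 0≤V fys≤V fxs≤V)) ⟩
      a * (s * d) + (a - b) * e
        ≤⟨ +-monoˡ-≤ ((a - b) * e) (*-monoʳ-≤ (*-nonNeg (powSlope-nonNeg l 0≤V) 0≤d) fy≤V) ⟩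
      V * (s * d) + (a - b) * e
        ≤⟨ +-monoʳ-≤ (V * (s * d)) (*-monoʳ-≤ (starProduct-nonNeg 0≤x x≤1 ms) (starFactor-increment m)) ⟩
      V * (s * d) + d * e
        ≤⟨ +-monoʳ-≤ (V * (s * d)) (*-monoˡ-≤ 0≤d (starProduct≤V^length 0≤x x≤1 ms fxs≤V)) ⟩
      V * (s * d) + d * V ^ l
        ≡⟨ solve 4 (λ V s d P → V :* (s :* d) :+ d :* P := (P :+ V :* s) :* d) refl V s d (V ^ l) ⟩
      (V ^ l + V * s) * d ∎
      where
      l = length ms
      a = starFactor m y
      b = starFactor m x
      c = starProduct ms y
      e = starProduct ms x
      s = powSlope l V
      d = y - x
      0≤d = p≤q⇒0≤q-p x≤y
      x≤1 = ≤-trans x≤y y≤1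

  -- Writing N = F_pre · f_m · F_post + E, the factor f_m has slope about 1 − (m+1)(1−y)^m,
  -- strongly negative while (1−y)^m is not small; the other factors and E must not undo this.
  module DominantFactor (pre : List ℕ) (m : ℕ) (post : List ℕ) (E : ℚ → ℚ) {x y y₀ V W R₀ e : ℚ}
    (0≤x : 0ℚ ≤ x) (x<y : x < y) (y≤y₀ : y ≤ y₀) (y₀≤1 : y₀ ≤ 1ℚ) (0≤V : 0ℚ ≤ V)
    (pre≤V-at-y : All (λ k → starFactor k y ≤ V) pre) (pre≤V-at-x : All (λ k → starFactor k x ≤ V) pre)
    (R₀≤R : R₀ ≤ starProduct pre x * starProduct post x)
    (W≤[1-y]^m : W ≤ (1ℚ - y) ^ m)
    (E-increment : E y - E x ≤ e * (y - x))
    where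

    N : ℚ → ℚ
    N p = starProduct (pre ++ m ∷ post) p + E p

    R : ℚ → ℚ
    R p = starProduct pre p * starProduct post p

    D : ℚ
    D = powSlope (length pre) V + V ^ length pre * fromℕ (length post)

    private
      a  = fromℕ (suc m)
      i  = length pre
      x≤y = <⇒≤ x<y
      y≤1 = ≤-trans y≤y₀ y₀≤1
      0≤y = ≤-trans 0≤x x≤y
      x≤1 = ≤-trans x≤y y≤1
      d  = y - x
      0≤d = p≤q⇒0≤q-p x≤y
      w  = (1ℚ - y) ^ m
      0≤D : 0ℚ ≤ D
      0≤D = +-nonNeg (powSlope-nonNeg i 0≤V) (*-nonNeg (^-nonNeg i 0≤V) (fromℕ-nonNeg (length post)))
      0≤R-x : 0ℚ ≤ R x
      0≤R-x = *-nonNeg (starProduct-nonNeg 0≤x x≤1 pre) (starProduct-nonNeg 0≤x x≤1 post)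

    N≡ : ∀ p → N p ≡ starFactor m p * R p + E p
    N≡ p = cong (_+ E p) (trans (starProduct-++ pre (m ∷ post) p)
      (solve 3 (λ a b c → a :* (b :* c) := b :* (a :* c)) refl (starProduct pre p) (starFactor m p) (starProduct post p)))

    R-x≤V^i : R x ≤ V ^ i
    R-x≤V^i = ≤-trans (*-mono-≤ (starProduct-nonNeg 0≤x x≤1 pre) (starProduct-nonNeg 0≤x x≤1 post)
                                 (starProduct≤V^length 0≤x x≤1 pre pre≤V-at-x) (starProduct≤1 0≤x x≤1 post))
                      (≤-reflexive (*-identityʳ _))

    R-increment : R y - R x ≤ D * d
    R-increment = begin
      Py * Qy - Px * Qx
        ≡⟨ solve 4 (λ a b c e → a :* c :- b :* e := (a :- b) :* c :+ b :* (c :- e)) refl Py Px Qy Qx ⟩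
      (Py - Px) * Qy + Px * (Qy - Qx)
        ≤⟨ +-monoˡ-≤ (Px * (Qy - Qx)) (*-monoʳ-≤ (starProduct-nonNeg 0≤y y≤1 post) (starProduct-increment 0≤x x≤y y≤1 pre 0≤V pre≤V-at-y pre≤V-at-x)) ⟩
      (s * d) * Qy + Px * (Qy - Qx)
        ≤⟨ +-monoˡ-≤ (Px * (Qy - Qx)) (≤-trans (*-monoˡ-≤ (*-nonNeg (powSlope-nonNeg i 0≤V) 0≤d) (starProduct≤1 0≤y y≤1 post)) (≤-reflexive (*-identityʳ (s * d)))) ⟩
      s * d + Px * (Qy - Qx)
        ≤⟨ +-monoʳ-≤ (s * d) (*-monoˡ-≤ (starProduct-nonNeg 0≤x x≤1 pre) (starProduct-increment 0≤x x≤y y≤1 post 0≤1 (all≤1 0≤y y≤1 post) (all≤1 0≤x x≤1 post))) ⟩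
      s * d + Px * (powSlope l 1ℚ * d)
        ≡⟨ cong (λ z → s * d + Px * (z * d)) (powSlope-1 l) ⟩
      s * d + Px * (fromℕ l * d)
        ≤⟨ +-monoʳ-≤ (s * d) (*-monoʳ-≤ (*-nonNeg (fromℕ-nonNeg l) 0≤d) (starProduct≤V^length 0≤x x≤1 pre pre≤V-at-x)) ⟩
      s * d + V ^ i * (fromℕ l * d)
        ≡⟨ solve 4 (λ s d P l → s :* d :+ P :* (l :* d) := (s :+ P :* l) :* d) refl s d (V ^ i) (fromℕ l) ⟩
      D * d ∎
      where
      Py = starProduct pre y
      Px = starProduct pre x
      Qy = starProduct post y
      Qx = starProduct post x
      s  = powSlope i V
      l  = length post
      all≤1 : ∀ {p} → 0ℚ ≤ p → p ≤ 1ℚ → ∀ ms → All (λ k → starFactor k p ≤ 1ℚ) ms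
      all≤1 0≤p p≤1 []       = []
      all≤1 0≤p p≤1 (k ∷ ks) = starFactor≤1 0≤p p≤1 k ∷ all≤1 0≤p p≤1 ks

    N-increment : N y - N x ≤ d * (R x + y * D + e + w * D - (a * w) * R x)
    N-increment = begin
      N y - N x
        ≡⟨ cong₂ _-_ (N≡ y) (N≡ x) ⟩
      (fy * R y + E y) - (fx * R x + E x)
        ≡⟨ solve 6 (λ fy fx Ry Rx Ey Ex → (fy :* Ry :+ Ey) :- (fx :* Rx :+ Ex) := (fy :- fx) :* Rx :+ fy :* (Ry :- Rx) :+ (Ey :- Ex)) refl fy fx (R y) (R x) (E y) (E x) ⟩
      (fy - fx) * R x + fy * (R y - R x) + (E y - E x)
        ≤⟨ +-monoˡ-≤ (E y - E x) (+-monoˡ-≤ (fy * (R y - R x)) (*-monoʳ-≤ 0≤R-x (starFactor-increment-sharp 0≤x x≤y y≤1 m))) ⟩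
      (d * (1ℚ - a * w)) * R x + fy * (R y - R x) + (E y - E x)
        ≤⟨ +-monoˡ-≤ (E y - E x) (+-monoʳ-≤ ((d * (1ℚ - a * w)) * R x) (*-monoˡ-≤ (starFactor-nonNeg 0≤y y≤1 m) R-increment)) ⟩
      (d * (1ℚ - a * w)) * R x + fy * (D * d) + (E y - E x)
        ≤⟨ +-monoˡ-≤ (E y - E x) (+-monoʳ-≤ ((d * (1ℚ - a * w)) * R x) (*-monoʳ-≤ (*-nonNeg 0≤D 0≤d) (starFactor≤p+[1-p]^m 0≤x x≤y y≤1 m))) ⟩
      (d * (1ℚ - a * w)) * R x + (y + w) * (D * d) + (E y - E x)
        ≤⟨ +-monoʳ-≤ ((d * (1ℚ - a * w)) * R x + (y + w) * (D * d)) E-increment ⟩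
      (d * (1ℚ - a * w)) * R x + (y + w) * (D * d) + e * d
        ≡⟨ solve 7 (λ d a w Rx y D e → (d :* (con 1ℚ :- a :* w)) :* Rx :+ (y :+ w) :* (D :* d) :+ e :* d := d :* (Rx :+ y :* D :+ e :+ w :* D :- (a :* w) :* Rx)) refl d a w (R x) y D e ⟩
      d * (R x + y * D + e + w * D - (a * w) * R x) ∎
      where
      fy = starFactor m y
      fx = starFactor m x

    decreases : D ≤ a * R₀ → V ^ i + y₀ * D + e + W * D < W * (a * R₀) → N y < N x
    decreases D≤aR₀ dominant = p-q<0⇒p<q (≤-<-trans N-increment (*-pos-neg (p<q⇒0<q-p x<y) bracket<0))
      where
      *-pos-neg : ∀ {u v} → 0ℚ < u → v < 0ℚ → u * v < 0ℚ
      *-pos-neg {u} {v} 0<u v<0 = subst (u * v <_) (*-zeroʳ u) (*-monoˡ-< 0<u v<0)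
      bracket<0 : R x + y * D + e + w * D - (a * w) * R x < 0ℚ
      bracket<0 = begin-strict
        R x + y * D + e + w * D - (a * w) * R x
          ≤⟨ -‿antimonoʳ-≤ (R x + y * D + e + w * D) (*-monoˡ-≤ (*-nonNeg (fromℕ-nonNeg (suc m)) (^-nonNeg m (p≤q⇒0≤q-p y≤1))) R₀≤R) ⟩
        R x + y * D + e + w * D - (a * w) * R₀
          ≤⟨ +-monoˡ-≤ (- ((a * w) * R₀)) (+-monoˡ-≤ (w * D) (+-monoˡ-≤ e (+-mono-≤ R-x≤V^i (*-monoʳ-≤ 0≤D y≤y₀)))) ⟩
        V ^ i + y₀ * D + e + w * D - (a * w) * R₀
          ≡⟨ solve 7 (λ A B e w D a R → A :+ B :+ e :+ w :* D :- (a :* w) :* R := A :+ B :+ e :+ w :* (D :- a :* R)) refl (V ^ i) (y₀ * D) e w D a R₀ ⟩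
        V ^ i + y₀ * D + e + w * (D - a * R₀)
          ≤⟨ +-monoʳ-≤ (V ^ i + y₀ * D + e) (*-antimonoˡ-≤ D-aR₀≤0 W≤[1-y]^m) ⟩
        V ^ i + y₀ * D + e + W * (D - a * R₀)
          ≡⟨ solve 6 (λ A B e W D aR → A :+ B :+ e :+ W :* (D :- aR) := (A :+ B :+ e :+ W :* D) :- W :* aR) refl (V ^ i) (y₀ * D) e W D (a * R₀) ⟩
        (V ^ i + y₀ * D + e + W * D) - W * (a * R₀) <⟨ +-monoˡ-< (- (W * (a * R₀))) dominant ⟩
        W * (a * R₀) - W * (a * R₀)                ≡⟨ +-inverseʳ (W * (a * R₀)) ⟩
        0ℚ                                         ∎
        where
        D-aR₀≤0 : D - a * R₀ ≤ 0ℚ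
        D-aR₀≤0 = subst (D - a * R₀ ≤_) (+-inverseʳ (a * R₀)) (+-monoˡ-≤ (- (a * R₀)) D≤aR₀)

module ScaleEstimates where

  open import Defs using (_^_)
  open RationalArithmetic
  open Dyadic
  open PendantClique using (size)
  open Reliability using (starFactor; starProduct; correction)
  open StarProduct
  open DecreasingIntervals using (DecreasingOnSegment)
  open import Data.Nat as ℕ using (ℕ; suc)
  import Data.Nat.Properties as ℕ
  open import Data.List using (List; _∷_; _++_; length)
  open import Data.List.Relation.Unary.All as All using (All)
  open import Data.Rational using (ℚ; 0ℚ; 1ℚ; ½; _+_; _*_; _-_; -_; _<_; _≤_)
  open import Data.Rational.Properties
  open import Relation.Nullary.Decidable using (toWitness)
  open import Data.Rational.Solver using (module +-*-Solver)
  open import Relation.Binary.PropositionalEquality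

  open +-*-Solver
  open ≤-Reasoning

  module _ (c : ℚ) (N : ℕ) (0≤c : 0ℚ ≤ c) where

    correction-increment : ∀ {x y} → 0ℚ ≤ x → x ≤ y → y ≤ 1ℚ →
                           correction c N y - correction c N x ≤ (c + fromℕ (suc N)) * (1ℚ - x) ^ N * (y - x)
    correction-increment {x} {y} 0≤x x≤y y≤1 = begin
      (c * y * Qy - Qy′) - (c * x * Qx - Qx′)
        ≡⟨ solve 7 (λ c x y Qy Qx Qy′ Qx′ → (c :* y :* Qy :- Qy′) :- (c :* x :* Qx :- Qx′) := c :* ((y :- x) :* Qy) :+ c :* (x :* (Qy :- Qx)) :+ (Qx′ :- Qy′)) refl c x y Qy Qx Qy′ Qx′ ⟩
      c * ((y - x) * Qy) + c * (x * (Qy - Qx)) + (Qx′ - Qy′)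
        ≤⟨ +-monoˡ-≤ (Qx′ - Qy′) (+-monoʳ-≤ (c * ((y - x) * Qy)) (*-monoˡ-≤ 0≤c (*-monoˡ-≤ 0≤x Qy-Qx≤0))) ⟩
      c * ((y - x) * Qy) + c * (x * 0ℚ) + (Qx′ - Qy′)
        ≤⟨ +-monoʳ-≤ (c * ((y - x) * Qy) + c * (x * 0ℚ)) (^-increment-upper 0≤1-y 1-y≤1-x N) ⟩
      c * ((y - x) * Qy) + c * (x * 0ℚ) + fromℕ (suc N) * Qx * ((1ℚ - x) - (1ℚ - y))
        ≤⟨ +-monoˡ-≤ (fromℕ (suc N) * Qx * ((1ℚ - x) - (1ℚ - y))) (+-monoˡ-≤ (c * (x * 0ℚ)) (*-monoˡ-≤ 0≤c (*-monoˡ-≤ (p≤q⇒0≤q-p x≤y) (^-monoˡ-≤ N 0≤1-y 1-y≤1-x)))) ⟩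
      c * ((y - x) * Qx) + c * (x * 0ℚ) + fromℕ (suc N) * Qx * ((1ℚ - x) - (1ℚ - y))
        ≡⟨ solve 5 (λ c x y Q n → c :* ((y :- x) :* Q) :+ c :* (x :* con 0ℚ) :+ n :* Q :* ((con 1ℚ :- x) :- (con 1ℚ :- y)) := (c :+ n) :* Q :* (y :- x)) refl c x y Qx (fromℕ (suc N)) ⟩
      (c + fromℕ (suc N)) * Qx * (y - x) ∎
      where
      Qx  = (1ℚ - x) ^ N
      Qy  = (1ℚ - y) ^ N
      Qx′ = (1ℚ - x) ^ suc N
      Qy′ = (1ℚ - y) ^ suc N
      0≤1-y = p≤q⇒0≤q-p y≤1
      1-y≤1-x = -‿antimonoʳ-≤ 1ℚ x≤y
      Qy-Qx≤0 : Qy - Qx ≤ 0ℚ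
      Qy-Qx≤0 = ≤-trans (+-monoˡ-≤ (- Qx) (^-monoˡ-≤ N 0≤1-y 1-y≤1-x)) (≤-reflexive (+-inverseʳ Qx))

    correction-lower : ∀ {p} → 0ℚ ≤ p → p ≤ 1ℚ → - ((1ℚ - p) ^ suc N) ≤ correction c N p
    correction-lower {p} 0≤p p≤1 = subst (_≤ correction c N p) (+-identityˡ _)
      (+-monoˡ-≤ (- ((1ℚ - p) ^ suc N)) (*-nonNeg (*-nonNeg 0≤c 0≤p) (^-nonNeg N (p≤q⇒0≤q-p p≤1))))

    correction-upper : ∀ {p} → 0ℚ ≤ p → p ≤ 1ℚ → correction c N p ≤ c * (1ℚ - p) ^ N
    correction-upper {p} 0≤p p≤1 = begin
      c * p * Q - (1ℚ - p) ^ suc N   ≤⟨ -‿antimonoʳ-≤ (c * p * Q) (^-nonNeg (suc N) 0≤1-p) ⟩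
      c * p * Q - 0ℚ                 ≡⟨ solve 3 (λ c p Q → c :* p :* Q :- con 0ℚ := c :* (p :* Q)) refl c p Q ⟩
      c * (p * Q)                    ≤⟨ *-monoˡ-≤ 0≤c (≤-trans (*-monoʳ-≤ (^-nonNeg N 0≤1-p) p≤1) (≤-reflexive (*-identityˡ Q))) ⟩
      c * Q                          ∎
      where
      Q = (1ℚ - p) ^ N
      0≤1-p = p≤q⇒0≤q-p p≤1

  starFactor≤p+½^ : ∀ e f {m p} → 2^ (e ℕ.+ f) ℕ.≤ suc m → ½ ^ e ≤ p → p ≤ 1ℚ → starFactor m p ≤ p + ½ ^ f
  starFactor≤p+½^ e f {m} {p} 2^e+f≤m+1 ½^e≤p p≤1 = +-monoʳ-≤ p (begin
    (1ℚ - p) ^ suc m            ≤⟨ ^-antimonoʳ-≤ (p≤q⇒0≤q-p p≤1) (0≤p⇒1-p≤1 (≤-trans (½^-nonNeg e) ½^e≤p)) 2^e+f≤m+1 ⟩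
    (1ℚ - p) ^ 2^ (e ℕ.+ f)     ≤⟨ decay-upper e f (e ℕ.+ f) ℕ.≤-refl ½^e≤p p≤1 ⟩
    ½ ^ 2^ f                    ≤⟨ ½^-antimono-≤ (ℕ.<⇒≤ (n<2^n f)) ⟩
    ½ ^ f                       ∎)

  ½≤starProduct : ∀ e ms {p} → size ms ℕ.≤ 2^ e → 0ℚ ≤ p → p ≤ ½ ^ suc e → ½ ≤ starProduct ms p
  ½≤starProduct e ms {p} size≤2^e 0≤p p≤½^e+1 = begin
    ½                                  ≡⟨ cong (λ z → 1ℚ - z) (sym (2^*½^suc e)) ⟩
    1ℚ - fromℕ (2^ e) * ½ ^ suc e      ≤⟨ -‿antimonoʳ-≤ 1ℚ (*-mono-≤ (fromℕ-nonNeg (size ms)) 0≤p (fromℕ-mono-≤ size≤2^e) p≤½^e+1) ⟩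
    1ℚ - fromℕ (size ms) * p           ≤⟨ bernoulli 0≤p p≤1 (size ms) ⟩
    (1ℚ - p) ^ size ms                 ≤⟨ [1-p]^size≤starProduct 0≤p p≤1 ms ⟩
    starProduct ms p                   ∎
    where p≤1 = ≤-trans p≤½^e+1 (½^-≤1 (suc e))

  sum-of-four< : ∀ {A B C D T Y k} → 0ℚ < Y → 1ℚ ≤ k → A ≤ Y * ½ ^ 2 → B ≤ Y * (½ ^ 2 * k) → C ≤ Y → D ≤ Y * k →
                 Y * (fromℕ 8 * k) ≤ T → A + B + C + D < T
  sum-of-four< {A} {B} {C} {D} {T} {Y} {k} 0<Y 1≤k A≤ B≤ C≤ D≤ ≤T = <-≤-trans (begin-strict
    A + B + C + D          ≤⟨ +-mono-≤ (+-mono-≤ (+-mono-≤ A≤Yk B≤Yk) C≤Yk) D≤ ⟩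
    Yk + Yk + Yk + Yk      ≡⟨ solve 1 (λ z → z :+ z :+ z :+ z := z :* con (fromℕ 4)) refl Yk ⟩
    Yk * fromℕ 4           <⟨ *-monoˡ-< (*-pos 0<Y 0<k) (toWitness {a? = fromℕ 4 <? fromℕ 8} _) ⟩
    Yk * fromℕ 8           ≡⟨ solve 3 (λ Y k e → (Y :* k) :* e := Y :* (e :* k)) refl Y k (fromℕ 8) ⟩
    Y * (fromℕ 8 * k)      ∎) ≤T
    where
    Yk = Y * k
    0≤Y = <⇒≤ 0<Y
    0<k = <-≤-trans 0<1 1≤k
    ¼≤1 = ½^-≤1 2
    Y≤Yk : Y ≤ Yk
    Y≤Yk = ≤-trans (≤-reflexive (sym (*-identityʳ Y))) (*-monoˡ-≤ 0≤Y 1≤k)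
    A≤Yk = ≤-trans A≤ (≤-trans (*-monoˡ-≤ 0≤Y ¼≤1) (≤-trans (≤-reflexive (*-identityʳ Y)) Y≤Yk))
    B≤Yk = ≤-trans B≤ (*-monoˡ-≤ 0≤Y (≤-trans (*-monoʳ-≤ (<⇒≤ 0<k) ¼≤1) (≤-reflexive (*-identityˡ k))))
    C≤Yk = ≤-trans C≤ Y≤Yk

  -- On [½^(σ+2), ½^(σ+1)] the factors of pre are saturated (at most ½^σ), the factor with
  -- 2^(ρ+σ) − 1 leaves is the dominant factor, and post is too small to matter.
  module DecreaseAtScale (pre : List ℕ) (m : ℕ) (post : List ℕ) (E : ℚ → ℚ) (e : ℚ) (σ ρ K i : ℕ)
    (ρ-large : 3 ℕ.+ 2 ℕ.* i ℕ.+ (K ℕ.+ 3) ℕ.≤ ρ)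
    (pre-saturated : All (λ k → 2^ (suc (suc σ) ℕ.+ suc σ) ℕ.≤ suc k) pre)
    (length-pre : length pre ≡ suc i)
    (length-blocks : suc i ℕ.+ length post ≡ K)
    (size-post : size post ℕ.≤ 2^ σ)
    (m+1≡ : suc m ≡ 2^ (ρ ℕ.+ σ))
    (2^ρ+2≤σ : 2^ ρ ℕ.+ 2 ℕ.≤ σ)
    (E-increment : ∀ x y → ½ ^ suc (suc σ) ≤ x → x ≤ y → y ≤ 1ℚ → E y - E x ≤ e * (y - x))
    (e≤ : e ≤ ½ ^ (2^ ρ ℕ.+ σ ℕ.* i))
    where

    private
      x₀ = ½ ^ suc (suc σ)
      y₀ = ½ ^ suc σ
      V  = ½ ^ σ
      W  = ½ ^ 2^ ρ
      U  = V ^ i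
      R₀ = x₀ ^ suc i * ½
      0≤x₀ = ½^-nonNeg (suc (suc σ))
      y₀≤1 = ½^-≤1 (suc σ)
      0≤V  = ½^-nonNeg σ
      0≤U  = ^-nonNeg i 0≤V
      r    = ρ ℕ.∸ (3 ℕ.+ 2 ℕ.* i)
      K+3≤r : K ℕ.+ 3 ℕ.≤ r
      K+3≤r = ℕ.≤-trans (ℕ.≤-reflexive (sym (ℕ.m+n∸m≡n (3 ℕ.+ 2 ℕ.* i) (K ℕ.+ 3)))) (ℕ.∸-monoˡ-≤ (3 ℕ.+ 2 ℕ.* i) ρ-large)
      ρ≡ : ρ ≡ 2 ℕ.+ (suc (2 ℕ.* i) ℕ.+ r)
      ρ≡ = sym (ℕ.m+[n∸m]≡n (ℕ.≤-trans (ℕ.m≤m+n (3 ℕ.+ 2 ℕ.* i) (K ℕ.+ 3)) ρ-large))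

    N : ℚ → ℚ
    N p = starProduct (pre ++ m ∷ post) p + E p

    pre≤V : ∀ p → x₀ ≤ p → p ≤ y₀ → All (λ k → starFactor k p ≤ V) pre
    pre≤V p x₀≤p p≤y₀ = All.map bound pre-saturated
      where
      bound : ∀ {k} → 2^ (suc (suc σ) ℕ.+ suc σ) ℕ.≤ suc k → starFactor k p ≤ V
      bound {k} 2^≤k+1 = begin
        starFactor k p   ≤⟨ starFactor≤p+½^ (suc (suc σ)) (suc σ) 2^≤k+1 x₀≤p (≤-trans p≤y₀ y₀≤1) ⟩
        p + y₀           ≤⟨ +-monoˡ-≤ y₀ p≤y₀ ⟩
        y₀ + y₀          ≡⟨ ½^suc+½^suc σ ⟩
        V                ∎

    R₀≤R : ∀ x → x₀ ≤ x → x ≤ y₀ → R₀ ≤ starProduct pre x * starProduct post x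
    R₀≤R x x₀≤x x≤y₀ = *-mono-≤ (^-nonNeg (suc i) 0≤x₀) 0≤½ x₀^≤pre (½≤starProduct σ post size-post 0≤x x≤y₀)
      where
      0≤x = ≤-trans 0≤x₀ x₀≤x
      x₀^≤pre : x₀ ^ suc i ≤ starProduct pre x
      x₀^≤pre = ≤-trans (^-monoˡ-≤ (suc i) 0≤x₀ x₀≤x)
                        (subst (λ l → x ^ l ≤ starProduct pre x) length-pre (p^length≤starProduct 0≤x (≤-trans x≤y₀ y₀≤1) pre))

    W≤[1-y]^m : ∀ y → 0ℚ ≤ y → y ≤ y₀ → W ≤ (1ℚ - y) ^ m
    W≤[1-y]^m y 0≤y y≤y₀ = begin
      W                          ≤⟨ decay-lower σ ρ (ρ ℕ.+ σ) (ℕ.≤-reflexive (ℕ.+-comm ρ σ)) ⟩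
      (1ℚ - y₀) ^ 2^ (ρ ℕ.+ σ)   ≡⟨ cong ((1ℚ - y₀) ^_) (sym m+1≡) ⟩
      (1ℚ - y₀) ^ suc m          ≤⟨ ^-monoˡ-≤ (suc m) (p≤q⇒0≤q-p y₀≤1) (-‿antimonoʳ-≤ 1ℚ y≤y₀) ⟩
      (1ℚ - y) ^ suc m           ≤⟨ ^-antimonoʳ-≤ (p≤q⇒0≤q-p (≤-trans y≤y₀ y₀≤1)) (0≤p⇒1-p≤1 0≤y) (ℕ.n≤1+n m) ⟩
      (1ℚ - y) ^ m               ∎

    D≤KU : powSlope (length pre) V + V ^ length pre * fromℕ (length post) ≤ fromℕ K * U
    D≤KU rewrite length-pre | powSlope-suc i V = begin
      fromℕ (suc i) * U + (V * U) * fromℕ (length post)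
        ≤⟨ +-monoʳ-≤ (fromℕ (suc i) * U) (*-monoʳ-≤ (fromℕ-nonNeg (length post)) (≤-trans (*-monoʳ-≤ 0≤U (½^-≤1 σ)) (≤-reflexive (*-identityˡ U)))) ⟩
      fromℕ (suc i) * U + U * fromℕ (length post)
        ≡⟨ solve 3 (λ a U b → a :* U :+ U :* b := (a :+ b) :* U) refl (fromℕ (suc i)) U (fromℕ (length post)) ⟩
      (fromℕ (suc i) + fromℕ (length post)) * U
        ≡⟨ cong (_* U) (trans (sym (fromℕ-+ (suc i) (length post))) (cong fromℕ length-blocks)) ⟩
      fromℕ K * U ∎

    [m+1]R₀≡2^r*U : fromℕ (suc m) * R₀ ≡ fromℕ (2^ r) * U
    [m+1]R₀≡2^r*U = begin-equality
      fromℕ (suc m) * ((x₀ * x₀ ^ i) * ½)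
        ≡⟨ cong₂ (λ a b → fromℕ a * ((x₀ * b) * ½)) (trans m+1≡ (cong 2^_ ρ+σ≡)) x₀^i≡ ⟩
      fromℕ (2^ (suc (suc σ) ℕ.+ Y)) * ((x₀ * (½ ^ (2 ℕ.* i) * U)) * ½)
        ≡⟨ solve 5 (λ n x h U t → n :* ((x :* (h :* U)) :* t) := (n :* x) :* (t :* h) :* U) refl (fromℕ (2^ (suc (suc σ) ℕ.+ Y))) x₀ (½ ^ (2 ℕ.* i)) U ½ ⟩
      (fromℕ (2^ (suc (suc σ) ℕ.+ Y)) * x₀) * ½ ^ suc (2 ℕ.* i) * U
        ≡⟨ cong (λ z → z * ½ ^ suc (2 ℕ.* i) * U) (2^+*½^ (suc (suc σ)) Y) ⟩
      fromℕ (2^ Y) * ½ ^ suc (2 ℕ.* i) * U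
        ≡⟨ cong (_* U) (2^+*½^ (suc (2 ℕ.* i)) r) ⟩
      fromℕ (2^ r) * U ∎
      where
      Y = suc (2 ℕ.* i) ℕ.+ r
      ρ+σ≡ : ρ ℕ.+ σ ≡ suc (suc σ) ℕ.+ Y
      ρ+σ≡ = trans (cong (ℕ._+ σ) ρ≡) (cong (λ z → suc (suc z)) (ℕ.+-comm Y σ))
      x₀^i≡ : x₀ ^ i ≡ ½ ^ (2 ℕ.* i) * U
      x₀^i≡ = begin-equality
        x₀ ^ i                ≡⟨ cong (_^ i) (^-distribˡ-+-* ½ 2 σ) ⟩
        (½ ^ 2 * V) ^ i       ≡⟨ ^-distribʳ-* (½ ^ 2) V i ⟩
        (½ ^ 2) ^ i * U       ≡⟨ cong (_* U) (^-*-assoc ½ 2 i) ⟩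
        ½ ^ (2 ℕ.* i) * U     ∎

    8K≤2^r : fromℕ 8 * fromℕ K ≤ fromℕ (2^ r)
    8K≤2^r = begin
      fromℕ 8 * fromℕ K
        ≡⟨ sym (fromℕ-* 8 K) ⟩
      fromℕ (8 ℕ.* K)
        ≤⟨ fromℕ-mono-≤ (ℕ.≤-trans (ℕ.*-monoʳ-≤ 8 (ℕ.<⇒≤ (n<2^n K))) (ℕ.≤-trans (ℕ.≤-reflexive (trans (ℕ.*-comm 8 (2^ K)) (sym (ℕ.^-distribˡ-+-* 2 K 3)))) (2^-mono-≤ K+3≤r))) ⟩
      fromℕ (2^ r) ∎

    D = powSlope (length pre) V + V ^ length pre * fromℕ (length post)
    0≤D : 0ℚ ≤ D
    0≤D = +-nonNeg (powSlope-nonNeg (length pre) 0≤V) (*-nonNeg (^-nonNeg (length pre) 0≤V) (fromℕ-nonNeg (length post)))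
    1≤K : 1ℚ ≤ fromℕ K
    1≤K = subst (λ k → 1ℚ ≤ fromℕ k) length-blocks (1≤fromℕ-suc (i ℕ.+ length post))
    KU≤[m+1]R₀ : fromℕ K * U ≤ fromℕ (suc m) * R₀
    KU≤[m+1]R₀ = ≤-trans (*-monoʳ-≤ 0≤U (≤-trans (≤-trans (≤-reflexive (sym (*-identityˡ (fromℕ K)))) (*-monoʳ-≤ (fromℕ-nonNeg K) (1≤fromℕ-suc 7))) 8K≤2^r))
                         (≤-reflexive (sym [m+1]R₀≡2^r*U))
    WU≡ : W * U ≡ ½ ^ (2^ ρ ℕ.+ σ ℕ.* i)
    WU≡ = trans (cong (W *_) (^-*-assoc ½ σ i)) (sym (^-distribˡ-+-* ½ (2^ ρ) (σ ℕ.* i)))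
    V≤W¼ : V ≤ W * ½ ^ 2
    V≤W¼ = ≤-trans (½^-antimono-≤ 2^ρ+2≤σ) (≤-reflexive (^-distribˡ-+-* ½ (2^ ρ) 2))
    0<WU : 0ℚ < W * U
    0<WU = subst (0ℚ <_) (sym WU≡) (½^-pos (2^ ρ ℕ.+ σ ℕ.* i))
    V^i≤ : V ^ length pre ≤ (W * U) * ½ ^ 2
    V^i≤ = begin
      V ^ length pre         ≡⟨ cong (V ^_) length-pre ⟩
      V * U                  ≤⟨ *-monoʳ-≤ 0≤U V≤W¼ ⟩
      (W * ½ ^ 2) * U        ≡⟨ solve 3 (λ W h U → (W :* h) :* U := (W :* U) :* h) refl W (½ ^ 2) U ⟩
      (W * U) * ½ ^ 2        ∎
    y₀D≤ : y₀ * D ≤ (W * U) * (½ ^ 2 * fromℕ K)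
    y₀D≤ = begin
      y₀ * D                       ≤⟨ *-monoʳ-≤ 0≤D (≤-trans (<⇒≤ (½^-suc< σ)) V≤W¼) ⟩
      (W * ½ ^ 2) * D              ≤⟨ *-monoˡ-≤ (*-nonNeg (½^-nonNeg (2^ ρ)) (½^-nonNeg 2)) D≤KU ⟩
      (W * ½ ^ 2) * (fromℕ K * U)  ≡⟨ solve 4 (λ W h k U → (W :* h) :* (k :* U) := (W :* U) :* (h :* k)) refl W (½ ^ 2) (fromℕ K) U ⟩
      (W * U) * (½ ^ 2 * fromℕ K)  ∎
    e≤WU : e ≤ W * U
    e≤WU = ≤-trans e≤ (≤-reflexive (sym WU≡))
    WD≤ : W * D ≤ (W * U) * fromℕ K
    WD≤ = ≤-trans (*-monoˡ-≤ (½^-nonNeg (2^ ρ)) D≤KU) (≤-reflexive (solve 3 (λ W k U → W :* (k :* U) := (W :* U) :* k) refl W (fromℕ K) U))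
    WU8K≤ : (W * U) * (fromℕ 8 * fromℕ K) ≤ W * (fromℕ (suc m) * R₀)
    WU8K≤ = begin
      (W * U) * (fromℕ 8 * fromℕ K)  ≤⟨ *-monoˡ-≤ (<⇒≤ 0<WU) 8K≤2^r ⟩
      (W * U) * fromℕ (2^ r)         ≡⟨ solve 3 (λ W U n → (W :* U) :* n := W :* (n :* U)) refl W U (fromℕ (2^ r)) ⟩
      W * (fromℕ (2^ r) * U)         ≡⟨ cong (W *_) (sym [m+1]R₀≡2^r*U) ⟩
      W * (fromℕ (suc m) * R₀)       ∎
    dominant : V ^ length pre + y₀ * D + e + W * D < W * (fromℕ (suc m) * R₀)
    dominant = sum-of-four< 0<WU 1≤K V^i≤ y₀D≤ e≤WU WD≤ WU8K≤

    decreasing : DecreasingOnSegment N x₀ y₀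
    decreasing x y x₀≤x y≤y₀ x<y =
      DominantFactor.decreases pre m post E 0≤x x<y y≤y₀ y₀≤1 0≤V
        (pre≤V y (≤-trans x₀≤x x≤y) y≤y₀) (pre≤V x x₀≤x (≤-trans x≤y y≤y₀)) (R₀≤R x x₀≤x (≤-trans x≤y y≤y₀))
        (W≤[1-y]^m y (≤-trans 0≤x x≤y) y≤y₀) (E-increment x y x₀≤x x≤y (≤-trans y≤y₀ y₀≤1))
        (≤-trans D≤KU KU≤[m+1]R₀) dominant
      where
      0≤x = ≤-trans 0≤x₀ x₀≤x
      x≤y = <⇒≤ x<y

  -- Between two scales the saturated factors of pre give F ≈ p^|pre|, which grows with p.
  module RiseBetweenScales (pre post : List ℕ) (c : ℚ) (N τ K : ℕ)
    (pre-saturated : All (λ k → 2^ (suc (suc (suc τ)) ℕ.+ suc (suc (suc τ))) ℕ.≤ suc k) pre)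
    (2≤length-pre : 2 ℕ.≤ length pre)
    (length-pre≤K : length pre ℕ.≤ K)
    (size-post : size post ℕ.≤ 2^ τ)
    (0≤c : 0ℚ ≤ c) (c≤N+1 : c ≤ fromℕ (suc N))
    (correction-small : fromℕ 2 * fromℕ (suc N) * (1ℚ - ½ ^ suc (suc (suc τ))) ^ N ≤ ½ ^ (suc τ ℕ.* K ℕ.+ 3))
    where

    F : ℚ → ℚ
    F p = starProduct (pre ++ post) p + correction c N p

    private
      s = ½ ^ suc (suc (suc τ))
      t = ½ ^ suc τ
      l = length pre
      0≤s = ½^-nonNeg (suc (suc (suc τ)))
      s≤1 = ½^-≤1 (suc (suc (suc τ)))
      0≤t = ½^-nonNeg (suc τ)
      t≤1 = ½^-≤1 (suc τ)
      Qs = (1ℚ - s) ^ N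
      0≤Qs = ^-nonNeg N (p≤q⇒0≤q-p s≤1)

    F-s≤ : F s ≤ (½ ^ suc (suc τ)) ^ l + c * Qs
    F-s≤ = +-mono-≤ product≤ (correction-upper c N 0≤c 0≤s s≤1)
      where
      pre≤ : All (λ k → starFactor k s ≤ ½ ^ suc (suc τ)) pre
      pre≤ = All.map bound pre-saturated
        where
        bound : ∀ {k} → 2^ (suc (suc (suc τ)) ℕ.+ suc (suc (suc τ))) ℕ.≤ suc k → starFactor k s ≤ ½ ^ suc (suc τ)
        bound {k} 2^≤k+1 = ≤-trans (starFactor≤p+½^ (suc (suc (suc τ))) (suc (suc (suc τ))) 2^≤k+1 ≤-refl s≤1) (≤-reflexive (½^suc+½^suc (suc (suc τ))))
      product≤ : starProduct (pre ++ post) s ≤ (½ ^ suc (suc τ)) ^ l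
      product≤ = begin
        starProduct (pre ++ post) s                 ≡⟨ starProduct-++ pre post s ⟩
        starProduct pre s * starProduct post s      ≤⟨ *-monoˡ-≤ (starProduct-nonNeg 0≤s s≤1 pre) (starProduct≤1 0≤s s≤1 post) ⟩
        starProduct pre s * 1ℚ                      ≡⟨ *-identityʳ _ ⟩
        starProduct pre s                           ≤⟨ starProduct≤V^length 0≤s s≤1 pre pre≤ ⟩
        (½ ^ suc (suc τ)) ^ l                       ∎

    F-t≥ : t ^ l * ½ - (1ℚ - t) ^ suc N ≤ F t
    F-t≥ = +-mono-≤ product≥ (correction-lower c N 0≤c 0≤t t≤1)
      where
      product≥ : t ^ l * ½ ≤ starProduct (pre ++ post) t
      product≥ = begin
        t ^ l * ½
          ≤⟨ *-mono-≤ (^-nonNeg l 0≤t) 0≤½ (p^length≤starProduct 0≤t t≤1 pre) (½≤starProduct τ post size-post 0≤t ≤-refl) ⟩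
        starProduct pre t * starProduct post t
          ≡⟨ sym (starProduct-++ pre post t) ⟩
        starProduct (pre ++ post) t ∎

    [2s]^l≤t^l¼ : (½ ^ suc (suc τ)) ^ l ≤ t ^ l * ½ ^ 2
    [2s]^l≤t^l¼ = begin
      (½ * t) ^ l         ≡⟨ ^-distribʳ-* ½ t l ⟩
      ½ ^ l * t ^ l       ≤⟨ *-monoʳ-≤ (^-nonNeg l 0≤t) (½^-antimono-≤ 2≤length-pre) ⟩
      ½ ^ 2 * t ^ l       ≡⟨ *-comm (½ ^ 2) (t ^ l) ⟩
      t ^ l * ½ ^ 2       ∎

    errors<t^l¼ : c * Qs + (1ℚ - t) ^ suc N < t ^ l * ½ ^ 2
    errors<t^l¼ = begin-strict
      c * Qs + (1ℚ - t) ^ suc N                   ≤⟨ +-mono-≤ (*-monoʳ-≤ 0≤Qs c≤N+1) Qt≤ ⟩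
      fromℕ (suc N) * Qs + fromℕ (suc N) * Qs     ≡⟨ solve 2 (λ n q → n :* q :+ n :* q := con (fromℕ 2) :* n :* q) refl (fromℕ (suc N)) Qs ⟩
      fromℕ 2 * fromℕ (suc N) * Qs                ≤⟨ correction-small ⟩
      ½ ^ (suc τ ℕ.* K ℕ.+ 3)                     <⟨ ½^-antimono-< (ℕ.+-monoʳ-< (suc τ ℕ.* K) (ℕ.n<1+n 2)) ⟩
      ½ ^ (suc τ ℕ.* K ℕ.+ 2)                     ≡⟨ ^-distribˡ-+-* ½ (suc τ ℕ.* K) 2 ⟩
      ½ ^ (suc τ ℕ.* K) * ½ ^ 2                   ≤⟨ *-monoʳ-≤ (½^-nonNeg 2) ½^τK≤t^l ⟩
      t ^ l * ½ ^ 2                               ∎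
      where
      Qt≤ : (1ℚ - t) ^ suc N ≤ fromℕ (suc N) * Qs
      Qt≤ = begin
        (1ℚ - t) ^ suc N      ≤⟨ ^-antimonoʳ-≤ (p≤q⇒0≤q-p t≤1) (0≤p⇒1-p≤1 0≤t) (ℕ.n≤1+n N) ⟩
        (1ℚ - t) ^ N          ≤⟨ ^-monoˡ-≤ N (p≤q⇒0≤q-p t≤1) (-‿antimonoʳ-≤ 1ℚ (½^-antimono-≤ (ℕ.m≤n+m (suc τ) 2))) ⟩
        Qs                    ≡⟨ sym (*-identityˡ Qs) ⟩
        1ℚ * Qs               ≤⟨ *-monoʳ-≤ 0≤Qs (1≤fromℕ-suc N) ⟩
        fromℕ (suc N) * Qs    ∎
      ½^τK≤t^l : ½ ^ (suc τ ℕ.* K) ≤ t ^ l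
      ½^τK≤t^l = begin
        ½ ^ (suc τ ℕ.* K)     ≡⟨ sym (^-*-assoc ½ (suc τ) K) ⟩
        t ^ K                 ≤⟨ ^-antimonoʳ-≤ 0≤t t≤1 length-pre≤K ⟩
        t ^ l                 ∎

    rises : F s < F t
    rises = ≤-<-trans F-s≤ (<-≤-trans (0<q-p⇒p<q (subst (0ℚ <_) rearrange (p<q⇒0<q-p sum<))) F-t≥)
      where
      A = (½ ^ suc (suc τ)) ^ l
      B = c * Qs
      C = (1ℚ - t) ^ suc N
      T = t ^ l * ½
      sum< : A + (B + C) < T
      sum< = subst (A + (B + C) <_) (trans (sym (*-distribˡ-+ (t ^ l) (½ ^ 2) (½ ^ 2))) (cong (t ^ l *_) (½^suc+½^suc 1)))
                   (+-mono-≤-< [2s]^l≤t^l¼ errors<t^l¼)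
      rearrange : T - (A + (B + C)) ≡ (T - C) - (A + B)
      rearrange = solve 4 (λ A B C T → T :- (A :+ (B :+ C)) := (T :- C) :- (A :+ B)) refl A B C T

module Parameters (k′ : ℕ) where

  open Dyadic using (2^_; 2^-mono-≤; n<2^n)
  open import Data.Nat using (zero; suc; _+_; _*_; _∸_; _≤_; _<_; z≤n; s≤s)
  open import Data.Nat.Properties
  open import Data.Nat.Solver using (module +-*-Solver)
  open import Data.Product using (_,_)
  open import Relation.Binary.PropositionalEquality

  open +-*-Solver

  ≤-by : ∀ a b {c} → a + b ≡ c → a ≤ c
  ≤-by a b a+b≡c = subst (a ≤_) a+b≡c (m≤m+n a b)

  -- Interval ι < K of decrease sits at p ≈ ½^σ(ι+1) and the
  -- rise after it at p ≈ ½^τ ι.  Consecutive scales satisfy 2 σ(j+1) + gap ≤ σ j, which keeps them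
  -- apart, and σ 0 is large enough to make the correction term negligible at all of them.
  K = suc k′
  ρ = 3 * K + 6
  gap = 2 * K + ρ + 6

  scale : ℕ → ℕ
  scale zero    = 2^ ρ + 2
  scale (suc d) = 2 * scale d + gap

  σ₁ = scale k′
  X = K + 5 + ρ + 2 * σ₁ + gap + 2^ ρ + σ₁ * K

  σ : ℕ → ℕ
  σ zero    = scale K + X
  σ (suc j) = scale (k′ ∸ j)

  M : ℕ → ℕ
  M j = 2^ (ρ + σ j) ∸ 1

  suc-M : ∀ j → suc (M j) ≡ 2^ (ρ + σ j)
  suc-M j = trans (sym (+-∸-assoc 1 (m^n>0 2 (ρ + σ j)))) (m+n∸m≡n 1 (2^ (ρ + σ j)))

  scale-suc : ∀ d → scale d ≤ scale (suc d)
  scale-suc d = ≤-trans (m≤m+n (scale d) (scale d + 0)) (m≤m+n (2 * scale d) gap)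

  scale-mono : ∀ {d d′} → d ≤ d′ → scale d ≤ scale d′
  scale-mono {d} d≤d′ with m≤n⇒∃[o]m+o≡n d≤d′
  ... | o , refl = go o
    where
    go : ∀ o → scale d ≤ scale (d + o)
    go zero    = ≤-reflexive (cong scale (sym (+-identityʳ d)))
    go (suc o) = ≤-trans (go o) (≤-trans (scale-suc (d + o)) (≤-reflexive (cong scale (sym (+-suc d o)))))

  scale-gap : ∀ {d d′} → d < d′ → 2 * scale d + gap ≤ scale d′
  scale-gap {d} {suc d′} (s≤s d≤d′) = +-monoˡ-≤ gap (*-monoʳ-≤ 2 (scale-mono d≤d′))

  σ-gap : ∀ j i → j < i → i ≤ K → 2 * σ i + gap ≤ σ j
  σ-gap zero      (suc i) _           (s≤s i≤k′) = ≤-trans (scale-gap {k′ ∸ i} {K} (s≤s (m∸n≤m k′ i))) (m≤m+n (scale K) X)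
  σ-gap (suc j) (suc i) (s≤s j<i) (s≤s i≤k′) = scale-gap (∸-monoʳ-< j<i i≤k′)

  σ-antimono : ∀ {a b} → a ≤ b → σ (suc b) ≤ σ (suc a)
  σ-antimono a≤b = scale-mono (∸-monoʳ-≤ k′ a≤b)

  σ≤σ₁ : ∀ ι → σ (suc ι) ≤ σ₁
  σ≤σ₁ ι = scale-mono (m∸n≤m k′ ι)

  σ≤σ₀ : ∀ j → j ≤ K → σ j ≤ σ 0
  σ≤σ₀ zero    _        = ≤-refl
  σ≤σ₀ (suc j) (s≤s j≤k′) = ≤-trans (≤-trans (m≤m+n (σ (suc j)) (σ (suc j) + 0)) (m≤m+n (2 * σ (suc j)) gap)) (σ-gap 0 (suc j) (s≤s z≤n) (s≤s j≤k′))

  2^ρ+2≤σ : ∀ ι → 2^ ρ + 2 ≤ σ (suc ι)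
  2^ρ+2≤σ ι = scale-mono {0} {k′ ∸ ι} z≤n

  3≤ρ : 3 ≤ ρ
  3≤ρ = ≤-by 3 (3 * K + 3) (solve 1 (λ k → con 3 :+ (con 3 :* k :+ con 3) := con 3 :* k :+ con 6) refl K)

  1+K≤ρ : suc K ≤ ρ
  1+K≤ρ = ≤-by (suc K) (2 * K + 5) (solve 1 (λ k → (con 1 :+ k) :+ (con 2 :* k :+ con 5) := con 3 :* k :+ con 6) refl K)

  ρ-large : ∀ ι → ι ≤ K → 3 + 2 * ι + (K + 3) ≤ ρ
  ρ-large ι ι≤K = ≤-trans (+-monoˡ-≤ (K + 3) (+-monoʳ-≤ 3 (*-monoʳ-≤ 2 ι≤K)))
                          (≤-reflexive (solve 1 (λ k → con 3 :+ con 2 :* k :+ (k :+ con 3) := con 3 :* k :+ con 6) refl K))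

  τ : ℕ → ℕ
  τ ι = K + (ρ + σ (suc (suc ι)))

  scale-saturation : ∀ z → suc (suc z) + suc z ≤ 2 * z + gap
  scale-saturation z = ≤-by (suc (suc z) + suc z) (2 * K + ρ + 3)
    (solve 3 (λ z k r → ((con 2 :+ z) :+ (con 1 :+ z)) :+ (con 2 :* k :+ r :+ con 3) := con 2 :* z :+ (con 2 :* k :+ r :+ con 6)) refl z K ρ)

  rise-saturation : ∀ ι → suc (suc (suc (τ ι))) + suc (suc (suc (τ ι))) ≤ ρ + (2 * σ (suc (suc ι)) + gap)
  rise-saturation ι = ≤-reflexive
    (solve 3 (λ z k r → (con 3 :+ (k :+ (r :+ z))) :+ (con 3 :+ (k :+ (r :+ z))) := r :+ (con 2 :* z :+ (con 2 :* k :+ r :+ con 6))) refl (σ (suc (suc ι))) K ρ)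

  rise<scale : ∀ ι → suc (suc (suc (τ ι))) ≤ 2 * σ (suc (suc ι)) + gap
  rise<scale ι = ≤-by (suc (suc (suc (τ ι)))) (z + K + 3)
    (solve 3 (λ z k r → (con 3 :+ (k :+ (r :+ z))) :+ (z :+ k :+ con 3) := con 2 :* z :+ (con 2 :* k :+ r :+ con 6)) refl z K ρ)
    where z = σ (suc (suc ι))

  post<scale : ∀ ι → τ ι ≤ 2 * σ (suc (suc ι)) + gap
  post<scale ι = ≤-by (τ ι) (z + K + 6)
    (solve 3 (λ z k r → (k :+ (r :+ z)) :+ (z :+ k :+ con 6) := con 2 :* z :+ (con 2 :* k :+ r :+ con 6)) refl z K ρ)
    where z = σ (suc (suc ι))

  size≤2^ : ∀ d e → d ≤ K → d * 2^ e ≤ 2^ (K + e)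
  size≤2^ d e d≤K = ≤-trans (*-monoˡ-≤ (2^ e) (≤-trans d≤K (<⇒≤ (n<2^n K)))) (≤-reflexive (sym (^-distribˡ-+-* 2 K e)))

  -- exponents for bounding the correction term at all scales up to σ₁
  E₀ = ρ + σ 0
  R  = 2^ ρ + σ₁ * K + 3
  f₀ = σ₁ + X
  e₀ = suc (suc K) + E₀

  e₀+R≡X+X : e₀ + R ≡ X + X
  e₀+R≡X+X = solve 3 (λ k s₁ t →
      (con 2 :+ K′ k) :+ (ρ′ k :+ ((con 2 :* s₁ :+ gap′ k) :+ X′ k s₁ t)) :+ (t :+ s₁ :* K′ k :+ con 3)
      := X′ k s₁ t :+ X′ k s₁ t) refl k′ σ₁ (2^ ρ)
    where
    K′ ρ′ gap′ : ∀ {n} → Polynomial n → Polynomial n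
    K′ k   = con 1 :+ k
    ρ′ k   = con 3 :* K′ k :+ con 6
    gap′ k = con 2 :* K′ k :+ ρ′ k :+ con 6
    X′ : ∀ {n} → Polynomial n → Polynomial n → Polynomial n → Polynomial n
    X′ k s₁ t = K′ k :+ con 5 :+ ρ′ k :+ con 2 :* s₁ :+ gap′ k :+ t :+ s₁ :* K′ k

  e₀+R≤2^f₀ : e₀ + R ≤ 2^ f₀
  e₀+R≤2^f₀ = begin
    e₀ + R            ≡⟨ e₀+R≡X+X ⟩
    X + X             ≤⟨ +-mono-≤ (<⇒≤ (n<2^n X)) (≤-trans (<⇒≤ (n<2^n X)) (m≤m+n (2^ X) 0)) ⟩
    2^ X + (2^ X + 0) ≡⟨ sym (^-distribˡ-+-* 2 1 X) ⟩
    2^ (1 + X)        ≤⟨ 2^-mono-≤ (+-monoˡ-≤ X 1≤σ₁) ⟩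
    2^ f₀             ∎
    where
    open ≤-Reasoning
    1≤σ₁ : 1 ≤ σ₁
    1≤σ₁ = ≤-trans (m≤n+m 1 (2^ ρ + 1)) (≤-trans (≤-reflexive (+-assoc (2^ ρ) 1 1)) (scale-mono {0} {k′} z≤n))

  σ₁+2+f₀≤E₀ : suc (suc σ₁) + f₀ ≤ E₀
  σ₁+2+f₀≤E₀ = ≤-by (suc (suc σ₁) + f₀) (3 * K + 4 + gap)
    (solve 4 (λ k s₁ x g → ((con 2 :+ s₁) :+ (s₁ :+ x)) :+ (con 3 :* k :+ con 4 :+ g) := (con 3 :* k :+ con 6) :+ ((con 2 :* s₁ :+ g) :+ x)) refl K σ₁ X gap)

module Construction (k′ : ℕ) where

  open import Defs using (_^_; nodeRel)
  open RationalArithmetic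
  open Dyadic
  open DecreasingIntervals
  open PendantClique using (size; pendantClique; applyUpTo-++; size-applyUpTo)
  open Reliability using (starProduct; correction; nodeRel-pendantClique)
  open ScaleEstimates
  open Parameters k′
  open import Data.Nat as ℕ using (suc; z≤n; s≤s)
  import Data.Nat.Properties as ℕ
  open import Data.List using (List; _∷_; _++_; length; applyUpTo)
  open import Data.List.Properties using (length-applyUpTo)
  open import Data.List.Relation.Unary.All using (All)
  open import Data.List.Relation.Unary.All.Properties using (applyUpTo⁺₁)
  open import Data.Rational using (ℚ; 0ℚ; 1ℚ; ½; _+_; _*_; _-_; _<_; _≤_)
  open import Data.Rational.Properties
  open import Data.Rational.Solver using (module +-*-Solver)
  open import Data.Sum using (inj₁; inj₂)
  open import Relation.Binary.PropositionalEquality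

  open +-*-Solver

  ms′ : List ℕ
  ms′ = applyUpTo (λ j → M (suc j)) K

  ms : List ℕ
  ms = M 0 ∷ ms′

  N : ℕ
  N = M 0 ℕ.+ size ms′

  c : ℚ
  c = fromℕ (suc N) - fromℕ (length ms)

  length-ms : length ms ≡ suc K
  length-ms = cong suc (length-applyUpTo (λ j → M (suc j)) K)

  f : ℚ → ℚ
  f = nodeRel (pendantClique ms)

  3≤size : 3 ℕ.≤ size ms
  3≤size = ℕ.≤-trans (ℕ.≤-trans 3≤ρ (ℕ.m≤m+n ρ (σ 0))) (ℕ.≤-trans (ℕ.<⇒≤ (n<2^n (ρ ℕ.+ σ 0)))
             (ℕ.≤-trans (ℕ.≤-reflexive (sym (suc-M 0))) (ℕ.m≤m+n (suc (M 0)) (size ms′))))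

  f≡ : ∀ p → f p ≡ starProduct ms p + correction c N p
  f≡ p = nodeRel-pendantClique (M 0) ms′ p 3≤size

  2^E₀≤N : 2^ E₀ ℕ.≤ N
  2^E₀≤N = ℕ.≤-trans (ℕ.≤-reflexive (sym (suc-M 0))) (subst (ℕ._≤ N) (ℕ.+-comm (M 0) 1) (ℕ.+-monoʳ-≤ (M 0) (s≤s z≤n)))

  0≤c : 0ℚ ≤ c
  0≤c = p≤q⇒0≤q-p (fromℕ-mono-≤ (subst (ℕ._≤ suc N) (sym length-ms) (s≤s (ℕ.≤-trans K≤ρ (ℕ.≤-trans (ℕ.<⇒≤ (n<2^n ρ)) (ℕ.≤-trans (2^-mono-≤ (ℕ.m≤m+n ρ (σ 0))) 2^E₀≤N))))))
    where
    K≤ρ = ℕ.≤-trans (ℕ.n≤1+n K) 1+K≤ρ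

  c≤N+1 : c ≤ fromℕ (suc N)
  c≤N+1 = 0≤q-p⇒p≤q (subst (0ℚ ≤_) (sym (solve 2 (λ a b → a :- (a :- b) := b) refl (fromℕ (suc N)) (fromℕ (length ms)))) (fromℕ-nonNeg (length ms)))

  2size≤2^e₀ : 2 ℕ.* size ms ℕ.≤ 2^ e₀
  2size≤2^e₀ = ℕ.≤-trans (ℕ.*-monoʳ-≤ 2 size≤) (ℕ.≤-trans (ℕ.≤-reflexive (sym (ℕ.*-assoc 2 (suc K) (2^ E₀))))
    (ℕ.≤-trans (ℕ.*-monoˡ-≤ (2^ E₀) (ℕ.*-monoʳ-≤ 2 (ℕ.<⇒≤ (n<2^n (suc K))))) (ℕ.≤-reflexive (sym (ℕ.^-distribˡ-+-* 2 (suc (suc K)) E₀)))))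
    where
    size≤ : size ms ℕ.≤ suc K ℕ.* 2^ E₀
    size≤ = size-applyUpTo M (suc K) λ {j} j<1+K → ℕ.≤-trans (ℕ.≤-reflexive (suc-M j)) (2^-mono-≤ (ℕ.+-monoʳ-≤ ρ (σ≤σ₀ j (ℕ.≤-pred j<1+K))))

  slope-bound : ℚ → ℚ
  slope-bound x₀ = fromℕ 2 * fromℕ (suc N) * (1ℚ - x₀) ^ N

  -- the doubly exponential decay of (1-x)^N beats the factor 2(N+1) at all scales up to σ₁
  slope-bound-small : ∀ x → ½ ^ suc (suc σ₁) ≤ x → x ≤ 1ℚ → slope-bound x ≤ ½ ^ R
  slope-bound-small x ½^≤x x≤1 = begin
    fromℕ 2 * fromℕ (suc N) * (1ℚ - x) ^ N       ≤⟨ *-mono-≤ (*-nonNeg (fromℕ-nonNeg 2) (fromℕ-nonNeg (suc N))) (^-nonNeg N 0≤1-x) 2[N+1]≤ [1-x]^N≤ ⟩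
    fromℕ (2^ e₀) * ½ ^ 2^ f₀                     ≤⟨ *-monoˡ-≤ (fromℕ-nonNeg (2^ e₀)) (½^-antimono-≤ e₀+R≤2^f₀) ⟩
    fromℕ (2^ e₀) * ½ ^ (e₀ ℕ.+ R)                ≡⟨ cong (fromℕ (2^ e₀) *_) (^-distribˡ-+-* ½ e₀ R) ⟩
    fromℕ (2^ e₀) * (½ ^ e₀ * ½ ^ R)              ≡⟨ sym (*-assoc (fromℕ (2^ e₀)) (½ ^ e₀) (½ ^ R)) ⟩
    fromℕ (2^ e₀) * ½ ^ e₀ * ½ ^ R                ≡⟨ cong (_* ½ ^ R) (2^*½^ e₀) ⟩
    1ℚ * ½ ^ R                                    ≡⟨ *-identityˡ (½ ^ R) ⟩
    ½ ^ R                                         ∎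
    where
    open ≤-Reasoning
    0≤x = ≤-trans (½^-nonNeg (suc (suc σ₁))) ½^≤x
    0≤1-x = p≤q⇒0≤q-p x≤1
    2[N+1]≤ : fromℕ 2 * fromℕ (suc N) ≤ fromℕ (2^ e₀)
    2[N+1]≤ = ≤-trans (≤-reflexive (sym (fromℕ-* 2 (suc N)))) (fromℕ-mono-≤ 2size≤2^e₀)
    [1-x]^N≤ : (1ℚ - x) ^ N ≤ ½ ^ 2^ f₀
    [1-x]^N≤ = ≤-trans (^-antimonoʳ-≤ 0≤1-x (0≤p⇒1-p≤1 0≤x) 2^E₀≤N) (decay-upper (suc (suc σ₁)) f₀ E₀ σ₁+2+f₀≤E₀ ½^≤x x≤1)

  correction-slope : ∀ x₀ → 0ℚ ≤ x₀ → ∀ x y → x₀ ≤ x → x ≤ y → y ≤ 1ℚ → correction c N y - correction c N x ≤ slope-bound x₀ * (y - x)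
  correction-slope x₀ 0≤x₀ x y x₀≤x x≤y y≤1 = ≤-trans (correction-increment c N 0≤c (≤-trans 0≤x₀ x₀≤x) x≤y y≤1)
    (*-monoʳ-≤ (p≤q⇒0≤q-p x≤y) (*-mono-≤ (+-nonNeg 0≤c (fromℕ-nonNeg (suc N))) (^-nonNeg N 0≤1-x) c+N+1≤ (^-monoˡ-≤ N 0≤1-x (-‿antimonoʳ-≤ 1ℚ x₀≤x))))
    where
    0≤1-x = p≤q⇒0≤q-p (≤-trans x≤y y≤1)
    c+N+1≤ : c + fromℕ (suc N) ≤ fromℕ 2 * fromℕ (suc N)
    c+N+1≤ = ≤-trans (+-monoˡ-≤ (fromℕ (suc N)) c≤N+1) (≤-reflexive (solve 1 (λ n → n :+ n := con (fromℕ 2) :* n) refl (fromℕ (suc N))))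

  -- interval ι lives on the scale σ (suc ι) of block suc ι
  module DecreasingAt (ι : ℕ) (ι≤k′ : ι ℕ.≤ k′) where

    d = k′ ℕ.∸ ι
    σι = σ (suc ι)
    pre = applyUpTo M (suc ι)
    post = applyUpTo (λ j → M (suc ι ℕ.+ suc j)) d

    ι+d≡k′ : ι ℕ.+ d ≡ k′
    ι+d≡k′ = ℕ.m+[n∸m]≡n ι≤k′

    ms-split : ms ≡ pre ++ M (suc ι) ∷ post
    ms-split = begin
      applyUpTo M (suc K)                ≡⟨ cong (λ k → applyUpTo M (suc k)) (sym (trans (ℕ.+-suc ι d) (cong suc ι+d≡k′))) ⟩
      applyUpTo M (suc ι ℕ.+ suc d)      ≡⟨ applyUpTo-++ M (suc ι) (suc d) ⟩
      pre ++ M (suc ι ℕ.+ 0) ∷ post      ≡⟨ cong (λ k → pre ++ M k ∷ post) (ℕ.+-identityʳ (suc ι)) ⟩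
      pre ++ M (suc ι) ∷ post            ∎
      where open ≡-Reasoning

    pre-saturated : All (λ k → 2^ (suc (suc σι) ℕ.+ suc σι) ℕ.≤ suc k) pre
    pre-saturated = applyUpTo⁺₁ M (suc ι) λ {j} j<1+ι →
      ℕ.≤-trans (2^-mono-≤ (ℕ.≤-trans (scale-saturation σι) (ℕ.≤-trans (σ-gap j (suc ι) j<1+ι (s≤s ι≤k′)) (ℕ.m≤n+m (σ j) ρ))))
                (ℕ.≤-reflexive (sym (suc-M j)))

    size-post : size post ℕ.≤ 2^ σι
    size-post with ℕ.m≤n⇒m<n∨m≡n ι≤k′
    ... | inj₂ refl = subst (λ n → size (applyUpTo (λ j → M (suc ι ℕ.+ suc j)) n) ℕ.≤ 2^ σι) (sym (ℕ.n∸n≡0 ι)) z≤n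
    ... | inj₁ ι<k′ = ℕ.≤-trans (size-applyUpTo _ d block≤) (ℕ.≤-trans (size≤2^ d (ρ ℕ.+ z) (ℕ.≤-trans (ℕ.m∸n≤m k′ ι) (ℕ.n≤1+n k′)))
                                (2^-mono-≤ (ℕ.≤-trans (post<scale ι) (σ-gap (suc ι) (suc (suc ι)) (ℕ.n<1+n (suc ι)) (s≤s ι<k′)))))
      where
      z = σ (suc (suc ι))
      block≤ : ∀ {j} → j ℕ.< d → suc (M (suc ι ℕ.+ suc j)) ℕ.≤ 2^ (ρ ℕ.+ z)
      block≤ {j} _ = ℕ.≤-trans (ℕ.≤-reflexive (suc-M (suc ι ℕ.+ suc j)))
                       (2^-mono-≤ (ℕ.+-monoʳ-≤ ρ (σ-antimono {suc ι} {ι ℕ.+ suc j} (ℕ.≤-trans (s≤s (ℕ.m≤m+n ι j)) (ℕ.≤-reflexive (sym (ℕ.+-suc ι j)))))))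

    x₀ = ½ ^ suc (suc σι)

    slope-bound≤ : slope-bound x₀ ≤ ½ ^ (2^ ρ ℕ.+ σι ℕ.* ι)
    slope-bound≤ = ≤-trans (slope-bound-small x₀ (½^-antimono-≤ (s≤s (s≤s (σ≤σ₁ ι)))) (½^-≤1 (suc (suc σι))))
      (½^-antimono-≤ (ℕ.≤-trans (ℕ.+-monoʳ-≤ (2^ ρ) (ℕ.*-mono-≤ (σ≤σ₁ ι) (ℕ.≤-trans ι≤k′ (ℕ.n≤1+n k′)))) (ℕ.m≤m+n _ 3)))

    decreasing : DecreasingOnSegment f x₀ (½ ^ suc σι)
    decreasing = DecreasingOnSegment-cong (λ p → trans (cong (λ l → starProduct l p + correction c N p) (sym ms-split)) (sym (f≡ p)))
      (DecreaseAtScale.decreasing pre (M (suc ι)) post (correction c N) (slope-bound x₀) σι ρ K ι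
        (ρ-large ι (ℕ.≤-trans ι≤k′ (ℕ.n≤1+n k′))) pre-saturated (length-applyUpTo M (suc ι))
        (cong suc (trans (cong (ι ℕ.+_) (length-applyUpTo _ d)) ι+d≡k′)) size-post (suc-M (suc ι)) (2^ρ+2≤σ ι)
        (correction-slope x₀ (½^-nonNeg (suc (suc σι)))) slope-bound≤)

  -- at the scale τ ι of the rise after interval ι, the blocks up to ι + 1 are saturated
  module RisingAfter (ι : ℕ) (ι<k′ : ι ℕ.< k′) where

    d = k′ ℕ.∸ ι
    z = σ (suc (suc ι))
    pre = applyUpTo M (suc (suc ι))
    post = applyUpTo (λ j → M (suc (suc ι) ℕ.+ j)) d

    ms-split : ms ≡ pre ++ post
    ms-split = trans (cong (λ k → applyUpTo M (suc (suc k))) (sym (ℕ.m+[n∸m]≡n (ℕ.<⇒≤ ι<k′)))) (applyUpTo-++ M (suc (suc ι)) d)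

    2+ι≤K : suc (suc ι) ℕ.≤ K
    2+ι≤K = s≤s ι<k′

    τ+3≤σ : suc (suc (suc (τ ι))) ℕ.≤ σ (suc ι)
    τ+3≤σ = ℕ.≤-trans (rise<scale ι) (σ-gap (suc ι) (suc (suc ι)) (ℕ.n<1+n (suc ι)) 2+ι≤K)

    τ+1≤σ₁ : suc (τ ι) ℕ.≤ σ₁
    τ+1≤σ₁ = ℕ.≤-trans (ℕ.≤-trans (ℕ.n≤1+n _) (ℕ.n≤1+n _)) (ℕ.≤-trans τ+3≤σ (σ≤σ₁ ι))

    pre-saturated : All (λ k → 2^ (suc (suc (suc (τ ι))) ℕ.+ suc (suc (suc (τ ι)))) ℕ.≤ suc k) pre
    pre-saturated = applyUpTo⁺₁ M (suc (suc ι)) λ {j} j<2+ι →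
      ℕ.≤-trans (2^-mono-≤ (ℕ.≤-trans (rise-saturation ι) (ℕ.+-monoʳ-≤ ρ (σ-gap j (suc (suc ι)) j<2+ι 2+ι≤K))))
                (ℕ.≤-reflexive (sym (suc-M j)))

    size-post : size post ℕ.≤ 2^ τ ι
    size-post = ℕ.≤-trans (size-applyUpTo _ d block≤) (size≤2^ d (ρ ℕ.+ z) (ℕ.≤-trans (ℕ.m∸n≤m k′ ι) (ℕ.n≤1+n k′)))
      where
      block≤ : ∀ {j} → j ℕ.< d → suc (M (suc (suc ι) ℕ.+ j)) ℕ.≤ 2^ (ρ ℕ.+ z)
      block≤ {j} _ = ℕ.≤-trans (ℕ.≤-reflexive (suc-M (suc (suc ι) ℕ.+ j))) (2^-mono-≤ (ℕ.+-monoʳ-≤ ρ (σ-antimono (ℕ.m≤m+n (suc ι) j))))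

    slope-bound≤ : slope-bound (½ ^ suc (suc (suc (τ ι)))) ≤ ½ ^ (suc (τ ι) ℕ.* K ℕ.+ 3)
    slope-bound≤ = ≤-trans (slope-bound-small _ (½^-antimono-≤ (s≤s (s≤s τ+1≤σ₁))) (½^-≤1 (suc (suc (suc (τ ι))))))
      (½^-antimono-≤ (ℕ.+-monoˡ-≤ 3 (ℕ.≤-trans (ℕ.*-monoˡ-≤ K τ+1≤σ₁) (ℕ.m≤n+m (σ₁ ℕ.* K) (2^ ρ)))))

    rises : f (½ ^ suc (suc (suc (τ ι)))) < f (½ ^ suc (τ ι))
    rises = subst₂ _<_ (f≡′ _) (f≡′ _)
      (RiseBetweenScales.rises pre post c N (τ ι) K pre-saturated
        (ℕ.≤-trans (s≤s (s≤s z≤n)) (ℕ.≤-reflexive (sym (length-applyUpTo M (suc (suc ι))))))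
        (ℕ.≤-trans (ℕ.≤-reflexive (length-applyUpTo M (suc (suc ι)))) 2+ι≤K)
        size-post 0≤c c≤N+1 slope-bound≤)
      where
      f≡′ : ∀ p → starProduct (pre ++ post) p + correction c N p ≡ f p
      f≡′ p = trans (cong (λ l → starProduct l p + correction c N p) (sym ms-split)) (sym (f≡ p))

  segments : SeparatedDecreasingSegments K f
  segments = record
    { lo         = λ ι → ½ ^ suc (suc (σ (suc ι)))
    ; hi         = λ ι → ½ ^ suc (σ (suc ι))
    ; s          = λ ι → ½ ^ suc (suc (suc (τ ι)))
    ; t          = λ ι → ½ ^ suc (τ ι)
    ; 0<lo       = λ ι _ → ½^-pos (suc (suc (σ (suc ι))))
    ; lo<hi      = λ ι _ → ½^-suc< (suc (σ (suc ι)))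
    ; hi<1       = λ ι _ → ½^-antimono-< {0} {suc (σ (suc ι))} (s≤s z≤n)
    ; decreasing = λ ι ι<K → DecreasingAt.decreasing ι (ℕ.≤-pred ι<K)
    ; hi≤s       = λ ι 1+ι<K → ½^-antimono-≤ {suc (suc (suc (τ ι)))} (ℕ.≤-trans (RisingAfter.τ+3≤σ ι (ℕ.≤-pred 1+ι<K)) (ℕ.n≤1+n _))
    ; s<t        = λ ι _ → ½^-antimono-< {suc (τ ι)} {suc (suc (suc (τ ι)))} (s≤s (ℕ.n≤1+n _))
    ; t≤lo       = λ ι _ → ½^-antimono-≤ {suc (suc (σ (suc (suc ι))))} (s≤s (s≤s (ℕ.≤-trans (ℕ.m≤n+m _ ρ) (ℕ.m≤n+m _ k′))))
    ; rises      = λ ι 1+ι<K → RisingAfter.rises ι (ℕ.≤-pred 1+ι<K)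
    }

open import Defs
open import Data.Nat using (ℕ; _≤_)
open import Data.Product using (Σ; _×_)
open import Data.Nat using (suc)
open import Data.Product using (_,_)

mainTheorem5 : (k : ℕ) → 1 ≤ k → Σ Graph (λ G → Connected G × AtLeastDecIntervals k (nodeRel G))
mainTheorem5 (suc k′) _ =
  pendantClique ms , pendantClique-connected ms 3≤size , separated⇒atLeastDecIntervals segments
  where
  open Construction k′
  open PendantClique using (pendantClique; pendantClique-connected)
  open DecreasingIntervals using (separated⇒atLeastDecIntervals)
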